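{- Let $\overline{P}(n,1)$ be the number of overpartitions of $n$ in which exactly one positive integer less than the largest part is missing. Then, for $|q|<1$, \[ \sum_{n=0}^{\infty}\overline{P}(n,1)q^n=(-2q;q)_{\infty}\sum_{k=1}^{\infty}\frac{2q^{2k}}{1+2q^k}. \] Moreover, $\overline{P}(n,1)$ equals the number of overpartitions of $n$ in which exactly one integer occurs exactly twice (either both occurrences non-overlined, or one overlined and one non-overlined) and every other integer that occurs does so exactly once (either non-overlined or overlined, but not both).
   Context: An overpartition of $n$ is a partition of $n$ in which the first occurrence of any integer may be overlined. The largest part is the largest integer occurring (overlined or not). A positive integer less than the largest part is missing if it occurs neither overlined nor non-overlined. Notation: $(a;q)_\infty=\prod_{i\ge1}(1-aq^{i-1})$. -}

module Defs where

open import Data.Nat using (ℕ; zero; suc; _∸_; _≤_; _<_; _≟_; _≤?_)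
open import Data.Nat.DivMod using (_%_; _/_)
open import Data.Integer as ℤ using (ℤ; +_; -_)
open import Data.Bool using (Bool; false; true)
open import Data.Product using (_×_; _,_; proj₁; Σ)
open import Data.List using (List; []; _∷_; map; filter; length; upTo; foldr)
open import Data.List.Relation.Unary.All using (All)
open import Data.List.Relation.Unary.Linked using (Linked)
open import Relation.Binary.PropositionalEquality using (_≡_)
open import Relation.Nullary using (yes; no)
open import Data.Nat as ℕ using ()

-- A part: (size , overlined?)
Part : Set
Part = ℕ × Bool

-- Canonical listing: parts in non-increasing order of size; among equal
-- sizes, only the first listed occurrence may be overlined.
data Step : Part → Part → Set where
  lt : ∀ {a b x y} → b < a → Step (a , x) (b , y)
  eq : ∀ {a x} → Step (a , x) (a , false)

parts : List Part → List ℕ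
parts = map proj₁

sumℕ : List ℕ → ℕ
sumℕ = foldr ℕ._+_ 0

record Overpartition (n : ℕ) : Set where
  constructor mkOP
  field
    ps       : List Part
    positive : All (λ p → 1 ≤ proj₁ p) ps
    sorted   : Linked Step ps
    total    : sumℕ (parts ps) ≡ n

open Overpartition public

largest : List Part → ℕ
largest []            = 0
largest ((a , _) ∷ _) = a

mult : ℕ → List Part → ℕ
mult v l = length (filter (v ≟_) (parts l))

missingCount : List Part → ℕ
missingCount l = length (filter (λ k → mult k l ≟ 0) (map suc (upTo (largest l ∸ 1))))

OneMissing : ℕ → Set
OneMissing n = Σ (Overpartition n) λ π → missingCount (ps π) ≡ 1

OneDouble : ℕ → Set
OneDouble n = Σ (Overpartition n) λ π →
  (length (filter (λ k → mult k (ps π) ≟ 2) (upTo (suc (largest (ps π))))) ≡ 1)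
  × (length (filter (λ k → 3 ≤? mult k (ps π)) (upTo (suc (largest (ps π))))) ≡ 0)

Series : Set
Series = ℕ → ℤ

sumℤ : List ℤ → ℤ
sumℤ = foldr ℤ._+_ (+ 0)

_⊛_ : Series → Series → Series
(f ⊛ g) n = sumℤ (map (λ i → f i ℤ.* g (n ∸ i)) (upTo (suc n)))

mono : ℤ → ℕ → Series
mono c m n with n ≟ m
... | yes _ = c
... | no  _ = + 0

one : Series
one = mono (+ 1) 0

_⊕_ : Series → Series → Series
(f ⊕ g) n = f n ℤ.+ g n

prodTo : ℕ → Series
prodTo zero    = one
prodTo (suc m) = prodTo m ⊛ (one ⊕ mono (+ 2) (suc m))

-- (-2q;q)_∞ : coefficient of q^n equals that of the finite product up to i = n
poch : Series
poch n = prodTo n n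

-- 1/(1 + 2 q^k) = Σ_{j≥0} (-2)^j q^{kj}   (k ≥ 1, given as suc k)
geomInv : ℕ → Series
geomInv k n with n % suc k ≟ 0
... | yes _ = (- (+ 2)) ℤ.^ (n / suc k)
... | no  _ = + 0

-- term 2 q^{2k} / (1 + 2 q^k) for k = suc k'
term : ℕ → Series
term k' = mono (+ 2) (2 ℕ.* suc k') ⊛ geomInv k'

-- Σ_{k≥1} 2q^{2k}/(1+2q^k) : terms with k > n do not contribute to q^n
termSum : Series
termSum n = sumℤ (map (λ k' → term k' n) (upTo n))

rhs : Series
rhs = poch ⊛ termSum

module Submission where

-- Let X d m be the overpartitions with d repeated values and all parts at most m, or
-- those with d missing values and at most m parts, as a series in q.  Both satisfy
--   X 0 (m + 1) = (1 + 2q^(m+1)) X 0 m,   X 1 (m + 1) = (1 + 2q^(m+1)) X 1 m + 2q^(2(m+1)) X 0 m.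
-- For repeated values, strip the parts equal to m + 1: there are none, one (possibly
-- overlined) or, when d = 1, two (the first possibly overlined).  For missing values and
-- exactly m + 1 parts, strip the first column of the Ferrers diagram, recording whether the
-- first part 1 is overlined; without a part 1 the value 1 is missing, and subtracting 1 from
-- every part keeps m + 1 parts and removes that missing value, after which a column can be
-- stripped.  The truncations ∏_{i≤m} (1 + 2q^i) and ∏_{i≤m} (1 + 2q^i) Σ_{k≤m} 2q^(2k)/(1 + 2q^k)
-- of the two sides satisfy the same recurrences, since (1 + 2q^(m+1)) 2q^(2(m+1))/(1 + 2q^(m+1))
-- is 2q^(2(m+1)); for m ≥ n neither the truncations nor the bound m change the coefficient of q^n.

open import Defs
open import Algebra.Bundles using (CommutativeMonoid)
open import Data.Nat.Base using (ℕ; zero; suc)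
open import Function using (_∘_)
open import Relation.Binary.PropositionalEquality using (_≡_; _≢_; refl; _≗_)

shift : ∀ {a} {A : Set a} → A → ℕ → (ℕ → A) → ℕ → A
shift z zero    f n       = f n
shift z (suc j) f zero    = z
shift z (suc j) f (suc n) = shift z j f n

shift-map : ∀ {a b} {A : Set a} {B : Set b} (g : A → B) z j f n → g (shift z j f n) ≡ shift (g z) j (g ∘ f) n
shift-map g z zero    f n       = refl
shift-map g z (suc j) f zero    = refl
shift-map g z (suc j) f (suc n) = shift-map g z j f n

module _ {a} {A : Set a} (z : A) where

  open import Data.Nat using (_∸_; _≤_; _<_; s≤s)

  shift-cong : ∀ j {f g} → f ≗ g → shift z j f ≗ shift z j g
  shift-cong zero    f≗g n       = f≗g n
  shift-cong (suc j) f≗g zero    = refl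
  shift-cong (suc j) f≗g (suc n) = shift-cong j f≗g n

  shift-< : ∀ j f {n} → n < j → shift z j f n ≡ z
  shift-< (suc j) f {zero}  _         = refl
  shift-< (suc j) f {suc n} (s≤s n<j) = shift-< j f n<j

  shift-≥ : ∀ j f {n} → j ≤ n → shift z j f n ≡ f (n ∸ j)
  shift-≥ zero    f         _         = refl
  shift-≥ (suc j) f {suc n} (s≤s j≤n) = shift-≥ j f j≤n

module FiniteSums {c ℓ} (M : CommutativeMonoid c ℓ) where

  open CommutativeMonoid M
  open import Algebra.Properties.CommutativeMonoid.Sum M using (sum; sum-syntax; sum-remove; sum-cong-≋)
  open import Data.Fin using (Fin; toℕ; punchIn)
  open import Data.Fin.Properties using (punchInᵢ≢i)
  open import Data.List using (foldr; map; applyUpTo)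
  open import Data.Vec.Functional using (removeAt)
  import Relation.Binary.PropositionalEquality as ≡
  open import Relation.Binary.Reasoning.Setoid setoid

  foldr-applyUpTo : ∀ (h : ℕ → Carrier) f k → foldr _∙_ ε (map h (applyUpTo f k)) ≡ ∑[ i < k ] h (f (toℕ i))
  foldr-applyUpTo h f zero    = ≡.refl
  foldr-applyUpTo h f (suc k) = ≡.cong (h (f 0) ∙_) (foldr-applyUpTo h (f ∘ suc) k)

  ∑-update : ∀ {R} (f g : Fin (suc R) → Carrier) a c → (∀ i → i ≢ a → f i ≈ g i) → f a ≈ g a ∙ c →
             ∑[ i < suc R ] f i ≈ ∑[ i < suc R ] g i ∙ c
  ∑-update f g a c same f≈g∙c = begin
    sum f                            ≈⟨ sum-remove {i = a} f ⟩
    f a ∙ sum (removeAt f a)         ≈⟨ ∙-cong f≈g∙c (sum-cong-≋ (λ j → same (punchIn a j) (punchInᵢ≢i a j))) ⟩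
    g a ∙ c ∙ sum (removeAt g a)     ≈⟨ assoc (g a) c _ ⟩
    g a ∙ (c ∙ sum (removeAt g a))   ≈⟨ ∙-congˡ (comm c _) ⟩
    g a ∙ (sum (removeAt g a) ∙ c)   ≈⟨ assoc (g a) _ c ⟨
    g a ∙ sum (removeAt g a) ∙ c     ≈⟨ ∙-congʳ (sum-remove {i = a} g) ⟨
    sum g ∙ c                        ∎

module PowerSeries where

  open import Data.Nat as ℕ using (_∸_; _≤_; _<_; _≤′_; ≤′-refl; ≤′-step; z≤n; s≤s; _≟_; _%_; _/_)
  import Data.Nat.Properties as ℕ
  open import Data.Nat.DivMod using (m<n⇒m%n≡m; m≤n⇒[n∸m]%m≡n%m; m/n≡1+[m∸n]/n)
  open import Data.Integer using (ℤ; +_; -_; _+_; _*_; _^_)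
  import Data.Integer.Properties as ℤ
  open import Data.Fin using (Fin; toℕ; fromℕ; inject₁; opposite)
  open import Data.Fin.Properties using (toℕ<n; toℕ≤pred[n]; opposite-prop; toℕ-inject₁; toℕ-fromℕ)
  open import Data.Fin.Permutation using (reverse)
  open import Algebra.Properties.Semiring.Sum ℤ.+-*-semiring
    using (sum; sum-syntax; ∑-distrib-+; ∑-permute; *-distribˡ-sum; sum-init-last; sum-cong-≗; sum-replicate-zero)
  open FiniteSums ℤ.+-0-commutativeMonoid using (foldr-applyUpTo)
  open import Relation.Binary.PropositionalEquality
  open import Relation.Nullary using (Dec; yes; no; contradiction)
  open ≡-Reasoning

  ∑< : ℕ → (ℕ → ℤ) → ℤ
  ∑< k h = ∑[ i < k ] h (toℕ i)

  ∑<-cong : ∀ k {h h′ : ℕ → ℤ} → (∀ i → i < k → h i ≡ h′ i) → ∑< k h ≡ ∑< k h′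
  ∑<-cong k same = sum-cong-≗ (λ i → same (toℕ i) (toℕ<n i))

  ∑<-zero : ∀ k {h : ℕ → ℤ} → (∀ i → i < k → h i ≡ + 0) → ∑< k h ≡ + 0
  ∑<-zero k vanish = trans (∑<-cong k vanish) (sum-replicate-zero k)

  ∑<-suc : ∀ k (h : ℕ → ℤ) → ∑< (suc k) h ≡ ∑< k h + h k
  ∑<-suc k h = begin
    ∑< (suc k) h                                        ≡⟨ sum-init-last {k} (h ∘ toℕ) ⟩
    ∑[ i < k ] h (toℕ (inject₁ i)) + h (toℕ (fromℕ k))  ≡⟨ cong₂ _+_ (sum-cong-≗ {k} (cong h ∘ toℕ-inject₁))
                                                                     (cong h (toℕ-fromℕ k)) ⟩
    ∑< k h + h k                                        ∎

  ∑<-extend : ∀ d k {h : ℕ → ℤ} → (∀ i → k ≤ i → h i ≡ + 0) → ∑< (d ℕ.+ k) h ≡ ∑< k h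
  ∑<-extend zero    k         vanish = refl
  ∑<-extend (suc d) k {h} vanish = begin
    ∑< (suc (d ℕ.+ k)) h          ≡⟨ ∑<-suc (d ℕ.+ k) h ⟩
    ∑< (d ℕ.+ k) h + h (d ℕ.+ k)  ≡⟨ cong₂ _+_ (∑<-extend d k vanish) (vanish (d ℕ.+ k) (ℕ.m≤n+m k d)) ⟩
    ∑< k h + + 0                  ≡⟨ ℤ.+-identityʳ _ ⟩
    ∑< k h                        ∎

  scale : ℤ → Series → Series
  scale c f n = c * f n

  ⊛-∑ : ∀ f g n → (f ⊛ g) n ≡ ∑< (suc n) (λ i → f i * g (n ∸ i))
  ⊛-∑ f g n = foldr-applyUpTo (λ i → f i * g (n ∸ i)) (λ i → i) (suc n)

  ⊛-cong-≤ : ∀ {f f′ g g′} n → (∀ i → i ≤ n → f i ≡ f′ i) → (∀ i → i ≤ n → g i ≡ g′ i) →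
             (f ⊛ g) n ≡ (f′ ⊛ g′) n
  ⊛-cong-≤ {f} {f′} {g} {g′} n f≡f′ g≡g′ = begin
    (f ⊛ g) n                             ≡⟨ ⊛-∑ f g n ⟩
    ∑< (suc n) (λ i → f i * g (n ∸ i))    ≡⟨ ∑<-cong (suc n) (λ i i<1+n →
                                               cong₂ _*_ (f≡f′ i (ℕ.≤-pred i<1+n)) (g≡g′ (n ∸ i) (ℕ.m∸n≤m n i))) ⟩
    ∑< (suc n) (λ i → f′ i * g′ (n ∸ i))  ≡⟨ ⊛-∑ f′ g′ n ⟨
    (f′ ⊛ g′) n                           ∎

  ⊛-cong : ∀ {f f′ g g′} → f ≗ f′ → g ≗ g′ → f ⊛ g ≗ f′ ⊛ g′
  ⊛-cong f≗f′ g≗g′ n = ⊛-cong-≤ n (λ i _ → f≗f′ i) (λ i _ → g≗g′ i)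

  ⊛-congˡ : ∀ f {g g′} → g ≗ g′ → f ⊛ g ≗ f ⊛ g′
  ⊛-congˡ f = ⊛-cong {f} {f} (λ _ → refl)

  ⊛-congʳ : ∀ g {f f′} → f ≗ f′ → f ⊛ g ≗ f′ ⊛ g
  ⊛-congʳ g f≗f′ = ⊛-cong {g = g} {g′ = g} f≗f′ (λ _ → refl)

  ⊛-comm : ∀ f g → f ⊛ g ≗ g ⊛ f
  ⊛-comm f g n = begin
    (f ⊛ g) n
      ≡⟨ ⊛-∑ f g n ⟩
    ∑< (suc n) (λ i → f i * g (n ∸ i))
      ≡⟨ ∑-permute (λ i → f (toℕ i) * g (n ∸ toℕ i)) reverse ⟩
    ∑[ i < suc n ] (f (toℕ (opposite i)) * g (n ∸ toℕ (opposite i)))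
      ≡⟨ sum-cong-≗ reflect ⟩
    ∑< (suc n) (λ i → g i * f (n ∸ i))
      ≡⟨ ⊛-∑ g f n ⟨
    (g ⊛ f) n
      ∎
    where
    reflect : ∀ (i : Fin (suc n)) → f (toℕ (opposite i)) * g (n ∸ toℕ (opposite i)) ≡ g (toℕ i) * f (n ∸ toℕ i)
    reflect i = begin
      f (toℕ (opposite i)) * g (n ∸ toℕ (opposite i))
        ≡⟨ cong (λ k → f k * g (n ∸ k)) (opposite-prop i) ⟩
      f (n ∸ toℕ i) * g (n ∸ (n ∸ toℕ i))
        ≡⟨ cong (λ k → f (n ∸ toℕ i) * g k) (ℕ.m∸[m∸n]≡n (toℕ≤pred[n] i)) ⟩
      f (n ∸ toℕ i) * g (toℕ i)
        ≡⟨ ℤ.*-comm (f (n ∸ toℕ i)) (g (toℕ i)) ⟩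
      g (toℕ i) * f (n ∸ toℕ i)
        ∎

  ⊛-distribʳ-⊕ : ∀ f g h → (f ⊕ g) ⊛ h ≗ (f ⊛ h) ⊕ (g ⊛ h)
  ⊛-distribʳ-⊕ f g h n = begin
    ((f ⊕ g) ⊛ h) n
      ≡⟨ ⊛-∑ (f ⊕ g) h n ⟩
    ∑< (suc n) (λ i → (f i + g i) * h (n ∸ i))
      ≡⟨ sum-cong-≗ {suc n} (λ i → ℤ.*-distribʳ-+ (h (n ∸ toℕ i)) (f (toℕ i)) (g (toℕ i))) ⟩
    ∑< (suc n) (λ i → f i * h (n ∸ i) + g i * h (n ∸ i))
      ≡⟨ ∑-distrib-+ {suc n} (λ i → f (toℕ i) * h (n ∸ toℕ i)) (λ i → g (toℕ i) * h (n ∸ toℕ i)) ⟩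
    ∑< (suc n) (λ i → f i * h (n ∸ i)) + ∑< (suc n) (λ i → g i * h (n ∸ i))
      ≡⟨ cong₂ _+_ (⊛-∑ f h n) (⊛-∑ g h n) ⟨
    ((f ⊛ h) ⊕ (g ⊛ h)) n
      ∎

  ⊛-distribˡ-⊕ : ∀ f g h → h ⊛ (f ⊕ g) ≗ (h ⊛ f) ⊕ (h ⊛ g)
  ⊛-distribˡ-⊕ f g h n = begin
    (h ⊛ (f ⊕ g)) n        ≡⟨ ⊛-comm h (f ⊕ g) n ⟩
    ((f ⊕ g) ⊛ h) n        ≡⟨ ⊛-distribʳ-⊕ f g h n ⟩
    ((f ⊛ h) ⊕ (g ⊛ h)) n  ≡⟨ cong₂ _+_ (⊛-comm f h n) (⊛-comm g h n) ⟩
    ((h ⊛ f) ⊕ (h ⊛ g)) n  ∎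

  scale-⊛ : ∀ c f g → scale c f ⊛ g ≗ scale c (f ⊛ g)
  scale-⊛ c f g n = begin
    (scale c f ⊛ g) n
      ≡⟨ ⊛-∑ (scale c f) g n ⟩
    ∑< (suc n) (λ i → c * f i * g (n ∸ i))
      ≡⟨ sum-cong-≗ {suc n} (λ i → ℤ.*-assoc c (f (toℕ i)) (g (n ∸ toℕ i))) ⟩
    ∑< (suc n) (λ i → c * (f i * g (n ∸ i)))
      ≡⟨ *-distribˡ-sum {suc n} c (λ i → f (toℕ i) * g (n ∸ toℕ i)) ⟨
    c * ∑< (suc n) (λ i → f i * g (n ∸ i))
      ≡⟨ cong (c *_) (⊛-∑ f g n) ⟨
    scale c (f ⊛ g) n
      ∎

  shift-⊛ : ∀ j f g → shift (+ 0) j f ⊛ g ≗ shift (+ 0) j (f ⊛ g)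
  shift-⊛ zero    f g n       = refl
  shift-⊛ (suc j) f g zero    = refl
  shift-⊛ (suc j) f g (suc n) = begin
    (shift (+ 0) (suc j) f ⊛ g) (suc n)                     ≡⟨ ⊛-∑ (shift (+ 0) (suc j) f) g (suc n) ⟩
    + 0 + ∑< (suc n) (λ i → shift (+ 0) j f i * g (n ∸ i))  ≡⟨ ℤ.+-identityˡ _ ⟩
    ∑< (suc n) (λ i → shift (+ 0) j f i * g (n ∸ i))        ≡⟨ ⊛-∑ (shift (+ 0) j f) g n ⟨
    (shift (+ 0) j f ⊛ g) n                                 ≡⟨ shift-⊛ j f g n ⟩
    shift (+ 0) j (f ⊛ g) n                                 ∎

  shift-scale-⊛ : ∀ j c f g → shift (+ 0) j (scale c f) ⊛ g ≗ shift (+ 0) j (scale c (f ⊛ g))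
  shift-scale-⊛ j c f g n = trans (shift-⊛ j (scale c f) g n) (shift-cong (+ 0) j (scale-⊛ c f g) n)

  ⊛-shift-scale : ∀ j c f g → f ⊛ shift (+ 0) j (scale c g) ≗ shift (+ 0) j (scale c (f ⊛ g))
  ⊛-shift-scale j c f g n = begin
    (f ⊛ shift (+ 0) j (scale c g)) n  ≡⟨ ⊛-comm f (shift (+ 0) j (scale c g)) n ⟩
    (shift (+ 0) j (scale c g) ⊛ f) n  ≡⟨ shift-scale-⊛ j c g f n ⟩
    shift (+ 0) j (scale c (g ⊛ f)) n  ≡⟨ shift-cong (+ 0) j (cong (c *_) ∘ ⊛-comm g f) n ⟩
    shift (+ 0) j (scale c (f ⊛ g)) n  ∎

  mono-diag : ∀ c m → mono c m m ≡ c
  mono-diag c m with m ≟ m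
  ... | yes _  = refl
  ... | no m≢m = contradiction refl m≢m

  mono-off : ∀ c {m n} → n ≢ m → mono c m n ≡ + 0
  mono-off c {m} {n} n≢m with n ≟ m
  ... | yes n≡m = contradiction n≡m n≢m
  ... | no _    = refl

  mono-suc : ∀ c m n → mono c (suc m) (suc n) ≡ mono c m n
  mono-suc c m n with n ≟ m
  ... | yes refl = mono-diag c (suc n)
  ... | no n≢m   = mono-off c (n≢m ∘ ℕ.suc-injective)

  mono-shift : ∀ c m → mono c m ≗ shift (+ 0) m (mono c 0)
  mono-shift c zero    n       = refl
  mono-shift c (suc m) zero    = refl
  mono-shift c (suc m) (suc n) = trans (mono-suc c m n) (mono-shift c m n)

  mono₀-⊛ : ∀ c g → mono c 0 ⊛ g ≗ scale c g
  mono₀-⊛ c g n = begin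
    (mono c 0 ⊛ g) n                                         ≡⟨ ⊛-∑ (mono c 0) g n ⟩
    c * g n + ∑< n (λ i → mono c 0 (suc i) * g (n ∸ suc i))  ≡⟨ cong (_+_ (c * g n)) (∑<-zero n (λ _ _ → refl)) ⟩
    c * g n + + 0                                            ≡⟨ ℤ.+-identityʳ (c * g n) ⟩
    scale c g n                                              ∎

  mono-⊛ : ∀ c m g → mono c m ⊛ g ≗ shift (+ 0) m (scale c g)
  mono-⊛ c m g n = begin
    (mono c m ⊛ g) n                  ≡⟨ ⊛-congʳ g (mono-shift c m) n ⟩
    (shift (+ 0) m (mono c 0) ⊛ g) n  ≡⟨ shift-⊛ m (mono c 0) g n ⟩
    shift (+ 0) m (mono c 0 ⊛ g) n    ≡⟨ shift-cong (+ 0) m (mono₀-⊛ c g) n ⟩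
    shift (+ 0) m (scale c g) n       ∎

  one-⊛ : ∀ g → one ⊛ g ≗ g
  one-⊛ g n = trans (mono₀-⊛ (+ 1) g n) (ℤ.*-identityˡ (g n))

  ⊛-one : ∀ g → g ⊛ one ≗ g
  ⊛-one g n = trans (⊛-comm g one n) (one-⊛ g n)

  factor : ℕ → Series
  factor j = one ⊕ mono (+ 2) j

  ⊛-factor : ∀ j f → f ⊛ factor j ≗ f ⊕ shift (+ 0) j (scale (+ 2) f)
  ⊛-factor j f n = begin
    (f ⊛ factor j) n                        ≡⟨ ⊛-distribˡ-⊕ one (mono (+ 2) j) f n ⟩
    (f ⊛ one) n + (f ⊛ mono (+ 2) j) n      ≡⟨ cong₂ _+_ (⊛-one f n) (trans (⊛-comm f (mono (+ 2) j) n) (mono-⊛ (+ 2) j f n)) ⟩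
    f n + shift (+ 0) j (scale (+ 2) f) n   ∎

  ⊛-factor-assoc : ∀ j f g → (f ⊛ g) ⊛ factor j ≗ f ⊛ (g ⊛ factor j)
  ⊛-factor-assoc j f g n = begin
    ((f ⊛ g) ⊛ factor j) n                             ≡⟨ ⊛-factor j (f ⊛ g) n ⟩
    (f ⊛ g) n + shift (+ 0) j (scale (+ 2) (f ⊛ g)) n  ≡⟨ cong (_+_ ((f ⊛ g) n)) (⊛-shift-scale j (+ 2) f g n) ⟨
    (f ⊛ g) n + (f ⊛ shift (+ 0) j (scale (+ 2) g)) n  ≡⟨ ⊛-distribˡ-⊕ g (shift (+ 0) j (scale (+ 2) g)) f n ⟨
    (f ⊛ (g ⊕ shift (+ 0) j (scale (+ 2) g))) n        ≡⟨ ⊛-congˡ f (⊛-factor j g) n ⟨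
    (f ⊛ (g ⊛ factor j)) n                             ∎

  ⊛-factor-comm : ∀ j f g → (f ⊛ factor j) ⊛ g ≗ (f ⊛ g) ⊛ factor j
  ⊛-factor-comm j f g n = begin
    ((f ⊛ factor j) ⊛ g) n  ≡⟨ ⊛-comm (f ⊛ factor j) g n ⟩
    (g ⊛ (f ⊛ factor j)) n  ≡⟨ ⊛-factor-assoc j g f n ⟨
    ((g ⊛ f) ⊛ factor j) n  ≡⟨ ⊛-congʳ (factor j) (⊛-comm g f) n ⟩
    ((f ⊛ g) ⊛ factor j) n  ∎

  geomInv-∣ : ∀ k n → n % suc k ≡ 0 → geomInv k n ≡ (- + 2) ^ (n / suc k)
  geomInv-∣ k n n%≡0 with n % suc k ≟ 0
  ... | yes _   = refl
  ... | no n%≢0 = contradiction n%≡0 n%≢0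

  geomInv-∤ : ∀ k n → n % suc k ≢ 0 → geomInv k n ≡ + 0
  geomInv-∤ k n n%≢0 with n % suc k ≟ 0
  ... | yes n%≡0 = contradiction n%≡0 n%≢0
  ... | no _     = refl

  geomInv-rec : ∀ k n → suc k ≤ n → geomInv k n + + 2 * geomInv k (n ∸ suc k) ≡ + 0
  geomInv-rec k n k<n with n % suc k ≟ 0
  ... | no n%≢0  = cong (λ x → (+ 0) + (+ 2) * x) (geomInv-∤ k (n ∸ suc k) (n%≢0 ∘ trans (sym same%)))
    where same% = m≤n⇒[n∸m]%m≡n%m k<n
  ... | yes n%≡0 = begin
    (- + 2) ^ (n / suc k) + + 2 * geomInv k (n ∸ suc k)  ≡⟨ cong₂ (λ e x → (- + 2) ^ e + + 2 * x) (m/n≡1+[m∸n]/n k<n)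
                                                                 (geomInv-∣ k (n ∸ suc k) (trans same% n%≡0)) ⟩
    - + 2 * x + + 2 * x                                  ≡⟨ ℤ.*-distribʳ-+ x (- + 2) (+ 2) ⟨
    (- + 2 + + 2) * x                                    ≡⟨⟩
    + 0                                                  ∎
    where
    same% = m≤n⇒[n∸m]%m≡n%m k<n
    x = (- + 2) ^ ((n ∸ suc k) / suc k)

  geomInv-⊛-factor : ∀ k → geomInv k ⊛ factor (suc k) ≗ one
  geomInv-⊛-factor k n = trans (⊛-factor (suc k) (geomInv k) n) (coefficient n (suc k ℕ.≤? n))
    where
    coefficient : ∀ n → Dec (suc k ≤ n) → geomInv k n + shift (+ 0) (suc k) (scale (+ 2) (geomInv k)) n ≡ one n
    coefficient zero    (no _)    = refl
    coefficient (suc n) (no k≮n)  =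
      cong₂ _+_ (geomInv-∤ k (suc n) (ℕ.1+n≢0 ∘ trans (sym (m<n⇒m%n≡m n<k)))) (shift-< (+ 0) (suc k) _ n<k)
      where n<k = ℕ.≰⇒> k≮n
    coefficient n       (yes k<n) = begin
      geomInv k n + shift (+ 0) (suc k) (scale (+ 2) (geomInv k)) n
        ≡⟨ cong (_+_ (geomInv k n)) (shift-≥ (+ 0) (suc k) _ k<n) ⟩
      geomInv k n + + 2 * geomInv k (n ∸ suc k)
        ≡⟨ geomInv-rec k n k<n ⟩
      + 0
        ≡⟨ mono-off (+ 1) (ℕ.>⇒≢ (ℕ.<-≤-trans (s≤s z≤n) k<n)) ⟨
      one n
        ∎

  prodTo-suc : ∀ {m n} → n ≤ m → prodTo (suc m) n ≡ prodTo m n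
  prodTo-suc {m} {n} n≤m = begin
    prodTo (suc m) n                                             ≡⟨ ⊛-factor (suc m) (prodTo m) n ⟩
    prodTo m n + shift (+ 0) (suc m) (scale (+ 2) (prodTo m)) n  ≡⟨ cong (_+_ (prodTo m n)) (shift-< (+ 0) (suc m) _ (s≤s n≤m)) ⟩
    prodTo m n + + 0                                             ≡⟨ ℤ.+-identityʳ (prodTo m n) ⟩
    prodTo m n                                                   ∎

  poch-prodTo : ∀ {m n} → n ≤ m → poch n ≡ prodTo m n
  poch-prodTo = go ∘ ℕ.≤⇒≤′
    where
    go : ∀ {m n} → n ≤′ m → poch n ≡ prodTo m n
    go ≤′-refl       = refl
    go (≤′-step n≤m) = trans (go n≤m) (sym (prodTo-suc (ℕ.≤′⇒≤ n≤m)))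

  term-vanish : ∀ k n → n < 2 ℕ.* suc k → term k n ≡ + 0
  term-vanish k n n<2k = trans (mono-⊛ (+ 2) (2 ℕ.* suc k) (geomInv k) n) (shift-< (+ 0) (2 ℕ.* suc k) _ n<2k)

  termSumTo : ℕ → Series
  termSumTo m n = ∑< m (λ k → term k n)

  termSum-termSumTo : ∀ {m n} → n ≤ m → termSum n ≡ termSumTo m n
  termSum-termSumTo {m} {n} n≤m = begin
    termSum n                          ≡⟨ foldr-applyUpTo (λ k → term k n) (λ k → k) n ⟩
    termSumTo n n                      ≡⟨ ∑<-extend (m ∸ n) n (λ k n≤k → term-vanish k n (s≤s (ℕ.m≤n⇒m≤n+o _ n≤k))) ⟨
    ∑< (m ∸ n ℕ.+ n) (λ k → term k n)  ≡⟨ cong (λ r → termSumTo r n) (ℕ.m∸n+n≡m n≤m) ⟩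
    termSumTo m n                      ∎

  rhsTo : ℕ → Series
  rhsTo m = prodTo m ⊛ termSumTo m

  rhs-rhsTo : ∀ n → rhs n ≡ rhsTo n n
  rhs-rhsTo n = ⊛-cong-≤ n (λ _ → poch-prodTo) (λ _ → termSum-termSumTo)

  prodTo-⊛-geomInv : ∀ m → prodTo (suc m) ⊛ geomInv m ≗ prodTo m
  prodTo-⊛-geomInv m n = begin
    ((P ⊛ F) ⊛ G) n  ≡⟨ ⊛-factor-comm (suc m) P G n ⟩
    ((P ⊛ G) ⊛ F) n  ≡⟨ ⊛-factor-assoc (suc m) P G n ⟩
    (P ⊛ (G ⊛ F)) n  ≡⟨ ⊛-congˡ P (geomInv-⊛-factor m) n ⟩
    (P ⊛ one) n      ≡⟨ ⊛-one P n ⟩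
    P n              ∎
    where P = prodTo m; F = factor (suc m); G = geomInv m

  prodTo-⊛-term : ∀ m → prodTo (suc m) ⊛ term m ≗ shift (+ 0) (2 ℕ.* suc m) (scale (+ 2) (prodTo m))
  prodTo-⊛-term m n = begin
    (P′ ⊛ term m) n                                   ≡⟨ ⊛-congˡ P′ (mono-⊛ (+ 2) j (geomInv m)) n ⟩
    (P′ ⊛ shift (+ 0) j (scale (+ 2) (geomInv m))) n  ≡⟨ ⊛-shift-scale j (+ 2) P′ (geomInv m) n ⟩
    shift (+ 0) j (scale (+ 2) (P′ ⊛ geomInv m)) n    ≡⟨ shift-cong (+ 0) j (cong (+ 2 *_) ∘ prodTo-⊛-geomInv m) n ⟩
    shift (+ 0) j (scale (+ 2) (prodTo m)) n          ∎
    where P′ = prodTo (suc m); j = 2 ℕ.* suc m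

  rhsTo-suc : ∀ m → rhsTo (suc m) ≗ (rhsTo m ⊛ factor (suc m)) ⊕ shift (+ 0) (2 ℕ.* suc m) (scale (+ 2) (prodTo m))
  rhsTo-suc m n = begin
    (P′ ⊛ termSumTo (suc m)) n                                  ≡⟨ ⊛-congˡ P′ (λ j → ∑<-suc m (λ k → term k j)) n ⟩
    (P′ ⊛ (T ⊕ term m)) n                                       ≡⟨ ⊛-distribˡ-⊕ T (term m) P′ n ⟩
    ((P ⊛ F) ⊛ T) n + (P′ ⊛ term m) n                           ≡⟨ cong₂ _+_ (⊛-factor-comm (suc m) P T n) (prodTo-⊛-term m n) ⟩
    ((P ⊛ T) ⊛ F) n + shift (+ 0) (2 ℕ.* suc m) (scale (+ 2) P) n  ∎
    where P = prodTo m; P′ = prodTo (suc m); F = factor (suc m); T = termSumTo m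

module Coefficients where

  open PowerSeries
  open import Data.Nat as ℕ using ()
  open import Data.Integer using (+_; _+_; _*_)
  import Data.Integer.Properties as ℤ
  open import Relation.Binary.PropositionalEquality
  open ≡-Reasoning

  extend : ℕ → (ℕ → ℕ) → ℕ → ℕ
  extend j f n = f n ℕ.+ shift 0 j (λ k → 2 ℕ.* f k) n

  prodToℕ : ℕ → ℕ → ℕ
  prodToℕ zero    zero    = 1
  prodToℕ zero    (suc n) = 0
  prodToℕ (suc m)         = extend (suc m) (prodToℕ m)

  rhsToℕ : ℕ → ℕ → ℕ
  rhsToℕ zero    n = 0
  rhsToℕ (suc m) n = extend (suc m) (rhsToℕ m) n ℕ.+ shift 0 (2 ℕ.* suc m) (λ k → 2 ℕ.* prodToℕ m k) n

  +-shift-double : ∀ j {f : ℕ → ℕ} {F : Series} → (∀ k → + f k ≡ F k) →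
                   ∀ n → + shift 0 j (λ k → 2 ℕ.* f k) n ≡ shift (+ 0) j (scale (+ 2) F) n
  +-shift-double j {f} f≡F n = trans (shift-map +_ 0 j (λ k → 2 ℕ.* f k) n)
                                     (shift-cong (+ 0) j (λ k → trans (ℤ.pos-* 2 (f k)) (cong (+ 2 *_) (f≡F k))) n)

  +-extend : ∀ j {f : ℕ → ℕ} {F : Series} → (∀ k → + f k ≡ F k) → ∀ n → + extend j f n ≡ (F ⊛ factor j) n
  +-extend j {f} {F} f≡F n = begin
    + extend j f n                           ≡⟨ ℤ.pos-+ (f n) _ ⟩
    + f n + + shift 0 j (λ k → 2 ℕ.* f k) n  ≡⟨ cong₂ _+_ (f≡F n) (+-shift-double j f≡F n) ⟩
    F n + shift (+ 0) j (scale (+ 2) F) n    ≡⟨ ⊛-factor j F n ⟨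
    (F ⊛ factor j) n                         ∎

  prodToℕ-prodTo : ∀ m n → + prodToℕ m n ≡ prodTo m n
  prodToℕ-prodTo zero    zero    = refl
  prodToℕ-prodTo zero    (suc n) = refl
  prodToℕ-prodTo (suc m) n       = +-extend (suc m) (prodToℕ-prodTo m) n

  rhsToℕ-rhsTo : ∀ m n → + rhsToℕ m n ≡ rhsTo m n
  rhsToℕ-rhsTo zero    n = sym (one-⊛ (termSumTo 0) n)
  rhsToℕ-rhsTo (suc m) n = begin
    + rhsToℕ (suc m) n
      ≡⟨ ℤ.pos-+ (extend (suc m) (rhsToℕ m) n) _ ⟩
    + extend (suc m) (rhsToℕ m) n + + shift 0 j (λ k → 2 ℕ.* prodToℕ m k) n
      ≡⟨ cong₂ _+_ (+-extend (suc m) (rhsToℕ-rhsTo m) n) (+-shift-double j (prodToℕ-prodTo m) n) ⟩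
    (rhsTo m ⊛ factor (suc m)) n + shift (+ 0) j (scale (+ 2) (prodTo m)) n
      ≡⟨ rhsTo-suc m n ⟨
    rhsTo (suc m) n
      ∎
    where j = 2 ℕ.* suc m

  rhsToℕ-rhs : ∀ n → + rhsToℕ n n ≡ rhs n
  rhsToℕ-rhs n = trans (rhsToℕ-rhsTo n n) (sym (rhs-rhsTo n))

module Counting where

  open Coefficients using (extend; prodToℕ; rhsToℕ)
  open import Data.Nat using (_+_; _*_)
  import Data.Nat.Properties as ℕ
  open import Data.Bool using (Bool)
  open import Data.Empty using (⊥-elim)
  open import Data.Fin using (Fin)
  open import Data.Fin.Properties using (+↔⊎; *↔×; 2↔Bool; 1↔⊤)
  open import Data.Product using (Σ; _×_; _,_)
  open import Data.Product.Function.Dependent.Propositional using (Σ-↔)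
  open import Data.Product.Function.NonDependent.Propositional using (_×-↔_)
  open import Data.Sum using (_⊎_; inj₁; [_,_])
  open import Data.Sum.Function.Propositional using (_⊎-↔_)
  open import Data.Unit using (tt)
  open import Function using (id)
  open import Function.Bundles using (_↔_; mk↔ₛ′)
  open import Function.Properties.Inverse using (↔-refl; ↔-trans; ↔-sym)
  open import Function.Related.Propositional using (module EquationalReasoning)
  open import Function.Related.TypeIsomorphisms using (⊎-assoc)
  open import Level using (0ℓ)
  open import Relation.Binary.PropositionalEquality using (_≡_; refl; cong; trans; sym)
  open import Relation.Nullary using (¬_)
  open EquationalReasoning

  -- j + k rather than k + j, so that Shifted 0 F n computes to Σ ℕ λ k → n ≡ k × F k.
  Shifted : ℕ → (ℕ → Set) → ℕ → Set
  Shifted j F n = Σ ℕ λ k → n ≡ j + k × F k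

  empty↔Fin0 : ∀ {A : Set} → ¬ A → A ↔ Fin 0
  empty↔Fin0 ¬a = mk↔ₛ′ (⊥-elim ∘ ¬a) (λ ()) (λ ()) (⊥-elim ∘ ¬a)

  ⊎-emptyʳ : ∀ {A B : Set} → ¬ B → (A ⊎ B) ↔ A
  ⊎-emptyʳ ¬b = mk↔ₛ′ [ id , ⊥-elim ∘ ¬b ] inj₁ (λ _ → refl) [ (λ _ → refl) , ⊥-elim ∘ ¬b ]

  Shifted-zero : ∀ {F n} → Shifted 0 F n ↔ F n
  Shifted-zero {n = n} = mk↔ₛ′ (λ { (_ , refl , x) → x }) (λ x → n , refl , x) (λ _ → refl) (λ { (_ , refl , _) → refl })

  Shifted-suc : ∀ {j F n} → Shifted (suc j) F (suc n) ↔ Shifted j F n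
  Shifted-suc = mk↔ₛ′ (λ { (k , n≡ , x) → k , ℕ.suc-injective n≡ , x })
                      (λ { (k , n≡ , x) → k , cong suc n≡ , x })
                      (λ { (k , _ , x) → cong (λ p → k , p , x) (ℕ.≡-irrelevant _ _) })
                      (λ { (k , _ , x) → cong (λ p → k , p , x) (ℕ.≡-irrelevant _ _) })

  Shifted-count : ∀ j {F f} → (∀ k → F k ↔ Fin (f k)) → ∀ n → Shifted j F n ↔ Fin (shift 0 j f n)
  Shifted-count zero    F↔ n       = ↔-trans Shifted-zero (F↔ n)
  Shifted-count (suc j) F↔ zero    = empty↔Fin0 λ ()
  Shifted-count (suc j) F↔ (suc n) = ↔-trans Shifted-suc (Shifted-count j F↔ n)

  Shifted-cong : ∀ j {F G : ℕ → Set} → (∀ k → F k ↔ G k) → ∀ n → Shifted j F n ↔ Shifted j G n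
  Shifted-cong j F↔G n = Σ-↔ ↔-refl (↔-refl ×-↔ F↔G _)

  Shifted-cast : ∀ {i j F n} → i ≡ j → Shifted i F n ↔ Shifted j F n
  Shifted-cast refl = ↔-refl

  Shifted-Shifted : ∀ i j {F n} → Shifted i (Shifted j F) n ↔ Shifted (i + j) F n
  Shifted-Shifted i j {F} {n} = mk↔ₛ′ to from (λ _ → cong (λ p → _ , p , _) (ℕ.≡-irrelevant _ _)) from∘to
    where
    to : Shifted i (Shifted j F) n → Shifted (i + j) F n
    to (_ , n≡ , k , refl , x) = k , trans n≡ (sym (ℕ.+-assoc i j k)) , x
    from : Shifted (i + j) F n → Shifted i (Shifted j F) n
    from (k , n≡ , x) = j + k , trans n≡ (ℕ.+-assoc i j k) , k , refl , x
    from∘to : ∀ u → from (to u) ≡ u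
    from∘to (_ , _ , k , refl , x) = cong (λ p → _ , p , k , refl , x) (ℕ.≡-irrelevant _ _)

  Bool×-count : ∀ {A : Set} {a} → A ↔ Fin a → (Bool × A) ↔ Fin (2 * a)
  Bool×-count A↔ = ↔-trans (↔-sym 2↔Bool ×-↔ A↔) (↔-sym *↔×)

  ⊎-count : ∀ {A B : Set} {a b} → A ↔ Fin a → B ↔ Fin b → (A ⊎ B) ↔ Fin (a + b)
  ⊎-count A↔ B↔ = ↔-trans (A↔ ⊎-↔ B↔) (↔-sym +↔⊎)

  Extend : ℕ → (ℕ → Set) → ℕ → Set
  Extend j F n = F n ⊎ Shifted j (λ k → Bool × F k) n

  Extend-count : ∀ j {F f} → (∀ k → F k ↔ Fin (f k)) → ∀ n → Extend j F n ↔ Fin (extend j f n)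
  Extend-count j F↔ n = ⊎-count (F↔ n) (Shifted-count j (Bool×-count ∘ F↔) n)

  ≡0-count : ∀ n → (n ≡ 0) ↔ Fin (prodToℕ 0 n)
  ≡0-count zero    = ↔-trans (mk↔ₛ′ (λ _ → tt) (λ _ → refl) (λ _ → refl) (λ _ → ℕ.≡-irrelevant _ _)) (↔-sym 1↔⊤)
  ≡0-count (suc n) = empty↔Fin0 λ ()

  record Recurrence (X : ℕ → ℕ → ℕ → Set) : Set₁ where
    field
      Rest  : ℕ → ℕ → ℕ → Set
      base₀ : ∀ n → X 0 0 n ↔ (n ≡ 0)
      base₁ : ∀ n → ¬ X 1 0 n
      step  : ∀ d m n → X d (suc m) n ↔ (X d m n ⊎ (Shifted (suc m) (λ k → Bool × X d m k) n ⊎ Rest d m n))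
      rest₀ : ∀ m n → ¬ Rest 0 m n
      rest₁ : ∀ m n → Rest 1 m n ↔ Shifted (2 * suc m) (λ k → Bool × X 0 m k) n

  module _ {X : ℕ → ℕ → ℕ → Set} (rec : Recurrence X) where

    open Recurrence rec

    count₀ : ∀ m n → X 0 m n ↔ Fin (prodToℕ m n)
    count₀ zero    n = ↔-trans (base₀ n) (≡0-count n)
    count₀ (suc m) n = begin
      X 0 (suc m) n
        ↔⟨ step 0 m n ⟩
      (X 0 m n ⊎ (Shifted (suc m) (λ k → Bool × X 0 m k) n ⊎ Rest 0 m n))
        ↔⟨ ↔-refl ⊎-↔ ⊎-emptyʳ (rest₀ m n) ⟩
      Extend (suc m) (X 0 m) n
        ↔⟨ Extend-count (suc m) (count₀ m) n ⟩
      Fin (prodToℕ (suc m) n)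
        ∎

    count₁ : ∀ m n → X 1 m n ↔ Fin (rhsToℕ m n)
    count₁ zero    n = empty↔Fin0 (base₁ n)
    count₁ (suc m) n = begin
      X 1 (suc m) n
        ↔⟨ step 1 m n ⟩
      (X 1 m n ⊎ (Shifted (suc m) (λ k → Bool × X 1 m k) n ⊎ Rest 1 m n))
        ↔⟨ ↔-sym (⊎-assoc 0ℓ _ _ _) ⟩
      (Extend (suc m) (X 1 m) n ⊎ Rest 1 m n)
        ↔⟨ ⊎-count (Extend-count (suc m) (count₁ m) n)
                   (↔-trans (rest₁ m n) (Shifted-count (2 * suc m) (Bool×-count ∘ count₀ m) n)) ⟩
      Fin (rhsToℕ (suc m) n)
        ∎

module Overpartitions where

  open Counting using (Shifted)
  open import Data.Nat using (_+_; _≤_; _<_; _≟_)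
  import Data.Nat.Properties as ℕ
  open import Data.Bool using (Bool)
  open import Data.Empty using (⊥-elim)
  open import Data.List using (List; []; _∷_; _++_; length; filter)
  open import Data.List.Properties using (filter-accept; filter-reject; filter-++; map-++; length-++)
  open import Data.List.Relation.Unary.All as All using (All; []; _∷_)
  open import Data.List.Relation.Unary.Linked as Linked using (Linked; []; [-]; _∷_)
  open import Data.Product using (Σ; _×_; _,_; proj₁)
  open import Data.Sum using (_⊎_; inj₁; inj₂)
  open import Function.Bundles using (_↔_; mk↔ₛ′)
  open import Function.Properties.Inverse using (↔-trans)
  open import Function.Related.TypeIsomorphisms using (Σ-distribˡ-⊎)
  open import Relation.Binary.PropositionalEquality
  open import Relation.Nullary using (¬_)
  open import Relation.Nullary.Irrelevant using (Irrelevant)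

  size : List Part → ℕ
  size l = sumℕ (parts l)

  Positive : List Part → Set
  Positive = All (λ p → 1 ≤ proj₁ p)

  Step-irrelevant : ∀ {p q} → Irrelevant (Step p q)
  Step-irrelevant (lt b<a) (lt b<a′) = cong lt (ℕ.<-irrelevant b<a b<a′)
  Step-irrelevant (lt a<a) eq        = ⊥-elim (ℕ.<-irrefl refl a<a)
  Step-irrelevant eq       (lt a<a)  = ⊥-elim (ℕ.<-irrefl refl a<a)
  Step-irrelevant eq       eq        = refl

  sorted-bound : ∀ {a x t} → Linked Step ((a , x) ∷ t) → All (λ p → proj₁ p ≤ a) t
  sorted-bound [-]          = []
  sorted-bound (lt b<a ∷ s) = ℕ.<⇒≤ b<a ∷ All.map (λ c≤b → ℕ.≤-trans c≤b (ℕ.<⇒≤ b<a)) (sorted-bound s)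
  sorted-bound (eq ∷ s)     = ℕ.≤-refl ∷ sorted-bound s

  sorted-< : ∀ {a b y t} → b < a → Linked Step ((b , y) ∷ t) → All (λ p → proj₁ p < a) ((b , y) ∷ t)
  sorted-< b<a s = b<a ∷ All.map (λ c≤b → ℕ.≤-<-trans c≤b b<a) (sorted-bound s)

  sorted-∷ : ∀ {a x t} → All (λ p → proj₁ p < a) t → Linked Step t → Linked Step ((a , x) ∷ t)
  sorted-∷ []        [] = [-]
  sorted-∷ (b<a ∷ _) s  = lt b<a ∷ s

  mult-∷-≡ : ∀ a x t → mult a ((a , x) ∷ t) ≡ suc (mult a t)
  mult-∷-≡ a x t = cong length (filter-accept (a ≟_) refl)

  mult-∷-≢ : ∀ {k a} x t → k ≢ a → mult k ((a , x) ∷ t) ≡ mult k t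
  mult-∷-≢ {k} x t k≢a = cong length (filter-reject (k ≟_) k≢a)

  mult-< : ∀ {a t} → All (λ p → proj₁ p < a) t → mult a t ≡ 0
  mult-< []                            = refl
  mult-< {t = (_ , x) ∷ t} (b<a ∷ t<a) = trans (mult-∷-≢ x t (ℕ.>⇒≢ b<a)) (mult-< t<a)

  mult-++ : ∀ k xs ys → mult k (xs ++ ys) ≡ mult k xs + mult k ys
  mult-++ k xs ys = trans (cong (length ∘ filter (k ≟_)) (map-++ proj₁ xs ys))
                          (trans (cong length (filter-++ (k ≟_) (parts xs) (parts ys)))
                                 (length-++ (filter (k ≟_) (parts xs))))

  Overpartition-≡ : ∀ {n} {π π′ : Overpartition n} → ps π ≡ ps π′ → π ≡ π′
  Overpartition-≡ {π = mkOP l p s t} {mkOP .l p′ s′ t′} refl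
    with All.irrelevant ℕ.≤-irrelevant p p′ | Linked.irrelevant Step-irrelevant s s′ | ℕ.≡-irrelevant t t′
  ... | refl | refl | refl = refl

  OverpartitionsWith : (List Part → Set) → ℕ → Set
  OverpartitionsWith Q n = Σ (Overpartition n) (λ π → Q (ps π))

  module _ {Q : List Part → Set} (Q-irrelevant : ∀ l → Irrelevant (Q l)) where

    With-≡ : ∀ {n} {u v : OverpartitionsWith Q n} → ps (proj₁ u) ≡ ps (proj₁ v) → u ≡ v
    With-≡ {u = π , q} {π′ , q′} l≡l′ with Overpartition-≡ {π = π} {π′} l≡l′
    ... | refl = cong (π ,_) (Q-irrelevant _ q q′)

    Shifted-≡ : ∀ {j n k k′ e e′} {u : OverpartitionsWith Q k} {u′ : OverpartitionsWith Q k′} →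
                ps (proj₁ u) ≡ ps (proj₁ u′) → _≡_ {A = Shifted j (OverpartitionsWith Q) n} (k , e , u) (k′ , e′ , u′)
    Shifted-≡ {u = π , _} {π′ , _} l≡l′ with trans (sym (total π)) (trans (cong size l≡l′) (total π′))
    ... | refl = cong₂ (λ e u → _ , e , u) (ℕ.≡-irrelevant _ _) (With-≡ l≡l′)

    Flagged-≡ : ∀ {j n k k′ e e′ b b′} {u : OverpartitionsWith Q k} {u′ : OverpartitionsWith Q k′} →
                b ≡ b′ → ps (proj₁ u) ≡ ps (proj₁ u′) →
                _≡_ {A = Shifted j (λ k → Bool × OverpartitionsWith Q k) n} (k , e , b , u) (k′ , e′ , b′ , u′)
    Flagged-≡ {u = π , _} {π′ , _} refl l≡l′ with trans (sym (total π)) (trans (cong size l≡l′) (total π′))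
    ... | refl = cong₂ (λ e u → _ , e , _ , u) (ℕ.≡-irrelevant _ _) (With-≡ l≡l′)

    only-empty : (∀ {l} → Positive l → Q l → l ≡ []) → Q [] → ∀ n → OverpartitionsWith Q n ↔ (n ≡ 0)
    only-empty forced q[] n = mk↔ₛ′ to from (λ _ → ℕ.≡-irrelevant _ _) (λ u → With-≡ (sym (forced′ u)))
      where
      forced′ : (u : OverpartitionsWith Q n) → ps (proj₁ u) ≡ []
      forced′ (π , q) = forced (positive π) q
      to : OverpartitionsWith Q n → n ≡ 0
      to u@(π , _) = trans (sym (total π)) (cong size (forced′ u))
      from : n ≡ 0 → OverpartitionsWith Q n
      from n≡0 = mkOP [] [] [] (sym n≡0) , q[]

  only-empty-¬ : ∀ {Q : List Part → Set} → (∀ {l} → Positive l → Q l → l ≡ []) → ¬ Q [] →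
                 ∀ {n} → ¬ OverpartitionsWith Q n
  only-empty-¬ {Q} forced ¬q[] (π , q) = ¬q[] (subst Q (forced (positive π) q) q)

  ×-irrelevant : ∀ {A B : Set} → Irrelevant A → Irrelevant B → Irrelevant (A × B)
  ×-irrelevant A-irr B-irr (a , b) (a′ , b′) = cong₂ _,_ (A-irr a a′) (B-irr b b′)

  ⊎-irrelevant : ∀ {A B : Set} → Irrelevant A → Irrelevant B → (A → ¬ B) → Irrelevant (A ⊎ B)
  ⊎-irrelevant A-irr B-irr disjoint (inj₁ a) (inj₁ a′) = cong inj₁ (A-irr a a′)
  ⊎-irrelevant A-irr B-irr disjoint (inj₁ a) (inj₂ b)  = ⊥-elim (disjoint a b)
  ⊎-irrelevant A-irr B-irr disjoint (inj₂ b) (inj₁ a)  = ⊥-elim (disjoint a b)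
  ⊎-irrelevant A-irr B-irr disjoint (inj₂ b) (inj₂ b′) = cong inj₂ (B-irr b b′)

  Σ-prop-↔ : ∀ {A : Set} {P Q : A → Set} → (∀ a → Irrelevant (P a)) → (∀ a → Irrelevant (Q a)) →
             (∀ a → P a → Q a) → (∀ a → Q a → P a) → Σ A P ↔ Σ A Q
  Σ-prop-↔ P-irr Q-irr to from = mk↔ₛ′ (λ (a , p) → a , to a p) (λ (a , q) → a , from a q)
                                       (λ (a , _) → cong (a ,_) (Q-irr a _ _)) (λ (a , _) → cong (a ,_) (P-irr a _ _))

  split-with : ∀ {n} P Q R → (∀ l → Irrelevant (P l)) → (∀ l → Irrelevant (Q l)) → (∀ l → Irrelevant (R l)) →
               (∀ l → Q l → ¬ R l) → (∀ π → P (ps π) → Q (ps π) ⊎ R (ps π)) → (∀ l → Q l ⊎ R l → P l) →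
               OverpartitionsWith P n ↔ (OverpartitionsWith Q n ⊎ OverpartitionsWith R n)
  split-with P Q R P-irr Q-irr R-irr disjoint split join =
    ↔-trans (Σ-prop-↔ {P = λ π → P (ps π)} {Q = λ π → Q (ps π) ⊎ R (ps π)}
                      (P-irr ∘ ps) (λ π → ⊎-irrelevant (Q-irr (ps π)) (R-irr (ps π)) (disjoint (ps π))) split (join ∘ ps))
            Σ-distribˡ-⊎

module RepeatedParts where

  open Counting using (Shifted; Recurrence)
  open Overpartitions
  open import Data.Nat using (_+_; _*_; _≤_; _<_; z≤n; s≤s; _≟_)
  import Data.Nat.Properties as ℕ
  open import Data.Bool using (Bool; false)
  open import Data.List using (List; []; _∷_)
  open import Data.List.Relation.Unary.All as All using (All; []; _∷_)
  open import Data.List.Relation.Unary.Linked as Linked using (Linked; []; [-]; _∷_)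
  open import Data.Product using (_×_; _,_; proj₁)
  open import Data.Sum using (_⊎_; inj₁; inj₂)
  open import Data.Sum.Function.Propositional using (_⊎-↔_)
  open import Function.Bundles using (_↔_; mk↔ₛ′)
  open import Function.Properties.Inverse using (↔-refl; ↔-trans)
  open import Function.Related.TypeIsomorphisms using (Σ-distribˡ-⊎)
  open import Relation.Binary.PropositionalEquality
  open import Relation.Nullary using (¬_; yes; no; contradiction)
  open import Relation.Nullary.Irrelevant using (Irrelevant)

  isHead : ℕ → List Part → ℕ
  isHead a []            = 0
  isHead a ((b , _) ∷ _) with a ≟ b
  ... | yes _ = 1
  ... | no  _ = 0

  repeats : List Part → ℕ
  repeats []            = 0
  repeats ((a , _) ∷ l) = isHead a l + repeats l

  repeats-∷-< : ∀ {a x t} → All (λ p → proj₁ p < a) t → repeats ((a , x) ∷ t) ≡ repeats t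
  repeats-∷-< []                              = refl
  repeats-∷-< {a} {t = (b , _) ∷ _} (b<a ∷ _) with a ≟ b
  ... | yes refl = contradiction b<a (ℕ.<-irrefl refl)
  ... | no  _    = refl

  repeats-∷-≡ : ∀ a x y t → repeats ((a , x) ∷ (a , y) ∷ t) ≡ suc (repeats ((a , y) ∷ t))
  repeats-∷-≡ a x y t with a ≟ a
  ... | yes _  = refl
  ... | no a≢a = contradiction refl a≢a

  unrepeated-head : ∀ {a y t} → Linked Step ((a , y) ∷ t) → repeats ((a , y) ∷ t) ≡ 0 → All (λ p → proj₁ p < a) t
  unrepeated-head                 [-]          _   = []
  unrepeated-head                 (lt b<a ∷ s) _   = sorted-< b<a s
  unrepeated-head {a} {y} {_ ∷ t} (eq ∷ _)     rep = contradiction (trans (sym (repeats-∷-≡ a y false t)) rep) λ ()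

  PartsAtMost : ℕ → List Part → Set
  PartsAtMost m = All (λ p → proj₁ p ≤ m)

  Repeated : ℕ → ℕ → List Part → Set
  Repeated d m l = PartsAtMost m l × repeats l ≡ d

  WithRepeats : ℕ → ℕ → ℕ → Set
  WithRepeats d m = OverpartitionsWith (Repeated d m)

  data TopOnce (a : ℕ) : List Part → Set where
    once : ∀ x {t} → All (λ p → proj₁ p < a) t → TopOnce a ((a , x) ∷ t)

  data TopTwice (a : ℕ) : List Part → Set where
    twice : ∀ x t → TopTwice a ((a , x) ∷ (a , false) ∷ t)

  RepeatedOnce RepeatedTwice : ℕ → ℕ → List Part → Set
  RepeatedOnce  d m l = TopOnce (suc m) l × repeats l ≡ d
  RepeatedTwice d m l = TopTwice (suc m) l × Repeated d (suc m) l

  Repeated-irrelevant : ∀ {d m} l → Irrelevant (Repeated d m l)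
  Repeated-irrelevant _ = ×-irrelevant (All.irrelevant ℕ.≤-irrelevant) ℕ.≡-irrelevant

  RepeatedOnce-irrelevant : ∀ {d m} l → Irrelevant (RepeatedOnce d m l)
  RepeatedOnce-irrelevant _ (once x b , r) (once x b′ , r′) =
    cong₂ _,_ (cong (once x) (All.irrelevant ℕ.<-irrelevant b b′)) (ℕ.≡-irrelevant r r′)

  RepeatedTwice-irrelevant : ∀ {d m} l → Irrelevant (RepeatedTwice d m l)
  RepeatedTwice-irrelevant l (twice x t , p) (twice x t , p′) = cong (twice x t ,_) (Repeated-irrelevant l p p′)

  classify-top : ∀ {m l} → Linked Step l → PartsAtMost (suc m) l →
                 PartsAtMost m l ⊎ (TopOnce (suc m) l ⊎ TopTwice (suc m) l)
  classify-top {m} [] [] = inj₁ []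
  classify-top {m} {(a , x) ∷ t} s (a≤1+m ∷ _) with a ≟ suc m
  ... | no a≢1+m = inj₁ (a≤m ∷ All.map (λ b≤a → ℕ.≤-trans b≤a a≤m) (sorted-bound s))
    where a≤m = ℕ.≤-pred (ℕ.≤∧≢⇒< a≤1+m a≢1+m)
  classify-top {m} {(_ , x) ∷ []}    [-]          _ | yes refl = inj₂ (inj₁ (once x []))
  classify-top {m} {(_ , x) ∷ _ ∷ _} (lt b<a ∷ s) _ | yes refl = inj₂ (inj₁ (once x (sorted-< b<a s)))
  classify-top {m} {(_ , x) ∷ _ ∷ t} (eq ∷ _)     _ | yes refl = inj₂ (inj₂ (twice x t))

  split-top : ∀ d m n → WithRepeats d (suc m) n ↔
              (WithRepeats d m n ⊎ (OverpartitionsWith (RepeatedOnce d m) n ⊎ OverpartitionsWith (RepeatedTwice d m) n))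
  split-top d m n =
    ↔-trans (split-with (Repeated d (suc m)) (Repeated d m) (λ l → RepeatedOnce d m l ⊎ RepeatedTwice d m l)
                        Repeated-irrelevant Repeated-irrelevant
                        (λ l → ⊎-irrelevant (RepeatedOnce-irrelevant l) (RepeatedTwice-irrelevant l) (disjoint l))
                        below-top split join)
            (↔-refl ⊎-↔ Σ-distribˡ-⊎)
    where
    split : ∀ π → Repeated d (suc m) (ps π) → Repeated d m (ps π) ⊎ (RepeatedOnce d m (ps π) ⊎ RepeatedTwice d m (ps π))
    split π (b , r) with classify-top (sorted π) b
    ... | inj₁ b′         = inj₁ (b′ , r)
    ... | inj₂ (inj₁ top) = inj₂ (inj₁ (top , r))
    ... | inj₂ (inj₂ top) = inj₂ (inj₂ (top , b , r))
    join : ∀ l → Repeated d m l ⊎ (RepeatedOnce d m l ⊎ RepeatedTwice d m l) → Repeated d (suc m) l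
    join _ (inj₁ (b , r))               = All.map ℕ.m≤n⇒m≤1+n b , r
    join _ (inj₂ (inj₁ (once x b , r))) = ℕ.≤-refl ∷ All.map ℕ.<⇒≤ b , r
    join _ (inj₂ (inj₂ (_ , p)))        = p
    disjoint : ∀ l → RepeatedOnce d m l → ¬ RepeatedTwice d m l
    disjoint _ (once _ (a<a ∷ _) , _) (twice _ _ , _) = ℕ.<-irrefl refl a<a
    below-top : ∀ l → Repeated d m l → ¬ (RepeatedOnce d m l ⊎ RepeatedTwice d m l)
    below-top _ (a≤m ∷ _ , _) (inj₁ (once _ _ , _))  = ℕ.<-irrefl refl a≤m
    below-top _ (a≤m ∷ _ , _) (inj₂ (twice _ _ , _)) = ℕ.<-irrefl refl a≤m

  remove-top : ∀ d m n → OverpartitionsWith (RepeatedOnce d m) n ↔ Shifted (suc m) (λ k → Bool × WithRepeats d m k) n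
  remove-top d m n = mk↔ₛ′ to from (λ _ → Flagged-≡ Repeated-irrelevant refl refl) from∘to
    where
    to : OverpartitionsWith (RepeatedOnce d m) n → Shifted (suc m) (λ k → Bool × WithRepeats d m k) n
    to (mkOP _ pos s total , once x t<a , r) =
      _ , sym total , x ,
      mkOP _ (All.tail pos) (Linked.tail s) refl , All.map ℕ.≤-pred t<a , trans (sym (repeats-∷-< {x = x} t<a)) r
    from : Shifted (suc m) (λ k → Bool × WithRepeats d m k) n → OverpartitionsWith (RepeatedOnce d m) n
    from (_ , n≡ , x , mkOP t pos s total , t≤m , r) =
      mkOP _ (s≤s z≤n ∷ pos) (sorted-∷ t<a s) (trans (cong (suc m +_) total) (sym n≡)) ,
      once x t<a , trans (repeats-∷-< {x = x} t<a) r
      where t<a = All.map s≤s t≤m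
    from∘to : ∀ u → from (to u) ≡ u
    from∘to (_ , once _ _ , _) = With-≡ RepeatedOnce-irrelevant refl

  no-twice : ∀ m n → ¬ OverpartitionsWith (RepeatedTwice 0 m) n
  no-twice m n (_ , twice x t , _ , r) = contradiction (trans (sym (repeats-∷-≡ (suc m) x false t)) r) λ ()

  double-+ : ∀ a b → a + (a + b) ≡ 2 * a + b
  double-+ a b = trans (sym (ℕ.+-assoc a a b)) (cong (λ c → a + c + b) (sym (ℕ.+-identityʳ a)))

  remove-twice : ∀ m n → OverpartitionsWith (RepeatedTwice 1 m) n ↔ Shifted (2 * suc m) (λ k → Bool × WithRepeats 0 m k) n
  remove-twice m n = mk↔ₛ′ to from (λ _ → Flagged-≡ Repeated-irrelevant refl refl) from∘to
    where
    to : OverpartitionsWith (RepeatedTwice 1 m) n → Shifted (2 * suc m) (λ k → Bool × WithRepeats 0 m k) n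
    to (mkOP _ pos s total , twice x t , _ , r) =
      _ , trans (sym total) (double-+ (suc m) _) , x ,
      mkOP t (All.tail (All.tail pos)) (Linked.tail (Linked.tail s)) refl ,
      All.map ℕ.≤-pred t<a , trans (sym (repeats-∷-< {x = false} t<a)) r′
      where
      r′ = ℕ.suc-injective (trans (sym (repeats-∷-≡ (suc m) x false t)) r)
      t<a = unrepeated-head (Linked.tail s) r′
    from : Shifted (2 * suc m) (λ k → Bool × WithRepeats 0 m k) n → OverpartitionsWith (RepeatedTwice 1 m) n
    from (_ , n≡ , x , mkOP t pos s total , t≤m , r) =
      mkOP _ (s≤s z≤n ∷ s≤s z≤n ∷ pos) (eq ∷ sorted-∷ t<a s)
           (trans (double-+ (suc m) _) (trans (cong (2 * suc m +_) total) (sym n≡))) ,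
      twice x t , ℕ.≤-refl ∷ ℕ.≤-refl ∷ All.map ℕ.m≤n⇒m≤1+n t≤m ,
      trans (repeats-∷-≡ (suc m) x false t) (cong suc (trans (repeats-∷-< {x = false} t<a) r))
      where t<a = All.map s≤s t≤m
    from∘to : ∀ u → from (to u) ≡ u
    from∘to (_ , twice _ _ , _) = With-≡ RepeatedTwice-irrelevant refl

  parts≤0-empty : ∀ {l} → Positive l → PartsAtMost 0 l → l ≡ []
  parts≤0-empty []        []        = refl
  parts≤0-empty (1≤a ∷ _) (a≤0 ∷ _) = contradiction (ℕ.≤-trans 1≤a a≤0) λ ()

  repeats-recurrence : Recurrence WithRepeats
  repeats-recurrence = record
    { Rest  = λ d m → OverpartitionsWith (RepeatedTwice d m)
    ; base₀ = only-empty Repeated-irrelevant (λ pos → parts≤0-empty pos ∘ proj₁) ([] , refl)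
    ; base₁ = λ n → only-empty-¬ (λ pos → parts≤0-empty pos ∘ proj₁) (λ ())
    ; step  = λ d m n → ↔-trans (split-top d m n) (↔-refl ⊎-↔ (remove-top d m n ⊎-↔ ↔-refl))
    ; rest₀ = no-twice
    ; rest₁ = remove-twice
    }

module Multiplicities where

  open Overpartitions
  open RepeatedParts
  open import Data.Nat using (_+_; _∸_; _⊓_; _<_; s≤s; _≟_; _≤?_)
  import Data.Nat.Properties as ℕ
  open import Data.List using (List; []; _∷_; length; filter; map; upTo)
  open import Data.List.Relation.Unary.All as All using (All; []; _∷_)
  open import Data.List.Relation.Unary.Linked using (Linked; []; [-]; _∷_)
  open import Data.Product using (_×_; _,_; proj₁; map₁)
  open import Data.Fin using (toℕ; fromℕ<)
  open import Data.Fin.Properties using (toℕ-injective; toℕ-fromℕ<)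
  open import Function using (id)
  open import Function.Bundles using (_↔_)
  open import Relation.Binary.PropositionalEquality
  open import Relation.Nullary using (contradiction)
  open import Algebra.Properties.CommutativeMonoid.Sum ℕ.+-0-commutativeMonoid using (sum-syntax; sum-replicate-zero)
  open FiniteSums ℕ.+-0-commutativeMonoid using (foldr-applyUpTo; ∑-update)
  open ≡-Reasoning

  excess : List Part → ℕ → ℕ
  excess l R = sumℕ (map (λ k → mult k l ∸ 1) (upTo R))

  excess-[] : ∀ R → excess [] R ≡ 0
  excess-[] R = trans (foldr-applyUpTo (λ _ → 0) id R) (sum-replicate-zero R)

  excess-∷ : ∀ {R a} x t → a < R → excess ((a , x) ∷ t) R ≡ excess t R + 1 ⊓ mult a t
  excess-∷ {suc R} {a} x t a<R = begin
    excess ((a , x) ∷ t) (suc R)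
      ≡⟨ foldr-applyUpTo (λ k → mult k ((a , x) ∷ t) ∸ 1) id (suc R) ⟩
    ∑[ i < suc R ] (mult (toℕ i) ((a , x) ∷ t) ∸ 1)
      ≡⟨ ∑-update _ _ (fromℕ< a<R) (1 ⊓ mult a t) off on ⟩
    ∑[ i < suc R ] (mult (toℕ i) t ∸ 1) + 1 ⊓ mult a t
      ≡⟨ cong (_+ 1 ⊓ mult a t) (foldr-applyUpTo (λ k → mult k t ∸ 1) id (suc R)) ⟨
    excess t (suc R) + 1 ⊓ mult a t
      ∎
    where
    off : ∀ i → i ≢ fromℕ< a<R → mult (toℕ i) ((a , x) ∷ t) ∸ 1 ≡ mult (toℕ i) t ∸ 1
    off i i≢a = cong (_∸ 1) (mult-∷-≢ x t (λ i≡a → i≢a (toℕ-injective (trans i≡a (sym (toℕ-fromℕ< a<R))))))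
    split-pred : ∀ m → m ≡ m ∸ 1 + 1 ⊓ m
    split-pred zero    = refl
    split-pred (suc m) = ℕ.+-comm 1 m
    on : mult (toℕ (fromℕ< a<R)) ((a , x) ∷ t) ∸ 1 ≡ mult (toℕ (fromℕ< a<R)) t ∸ 1 + 1 ⊓ mult a t
    on rewrite toℕ-fromℕ< a<R | mult-∷-≡ a x t = split-pred (mult a t)

  repeats-excess-∷-< : ∀ {R a} x {t} → a < R → All (λ p → proj₁ p < a) t → repeats t ≡ excess t R →
                       repeats ((a , x) ∷ t) ≡ excess ((a , x) ∷ t) R
  repeats-excess-∷-< {R} {a} x {t} a<R t<a rep≡ = begin
    repeats ((a , x) ∷ t)      ≡⟨ repeats-∷-< {x = x} t<a ⟩
    repeats t                  ≡⟨ rep≡ ⟩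
    excess t R                 ≡⟨ ℕ.+-identityʳ _ ⟨
    excess t R + 0             ≡⟨ cong (λ c → excess t R + 1 ⊓ c) (mult-< t<a) ⟨
    excess t R + 1 ⊓ mult a t  ≡⟨ excess-∷ x t a<R ⟨
    excess ((a , x) ∷ t) R     ∎

  repeats-excess : ∀ {R l} → Linked Step l → All (λ p → proj₁ p < R) l → repeats l ≡ excess l R
  repeats-excess {R} [] [] = sym (excess-[] R)
  repeats-excess {R} {(a , x) ∷ []} [-] (a<R ∷ []) =
    repeats-excess-∷-< x a<R [] (sym (excess-[] R))
  repeats-excess {R} {(a , x) ∷ t} (lt b<a ∷ s) (a<R ∷ t<R) =
    repeats-excess-∷-< x a<R (sorted-< b<a s) (repeats-excess s t<R)
  repeats-excess {R} {(a , x) ∷ (_ , y) ∷ t} (eq ∷ s) (a<R ∷ t<R) = begin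
    repeats ((a , x) ∷ (a , y) ∷ t)                    ≡⟨ repeats-∷-≡ a x y t ⟩
    suc (repeats ((a , y) ∷ t))                        ≡⟨ cong suc (repeats-excess s t<R) ⟩
    suc (excess ((a , y) ∷ t) R)                       ≡⟨ ℕ.+-comm 1 _ ⟩
    excess ((a , y) ∷ t) R + 1                         ≡⟨ cong (λ c → excess ((a , y) ∷ t) R + 1 ⊓ c) (mult-∷-≡ a y t) ⟨
    excess ((a , y) ∷ t) R + 1 ⊓ mult a ((a , y) ∷ t)  ≡⟨ excess-∷ x ((a , y) ∷ t) a<R ⟨
    excess ((a , x) ∷ (a , y) ∷ t) R                   ∎

  module _ (h : ℕ → ℕ) where

    Twos Threes : List ℕ → ℕ
    Twos   ks = length (filter (λ k → h k ≟ 2) ks)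
    Threes ks = length (filter (λ k → 3 ≤? h k) ks)

    no-excess : ∀ ks → sumℕ (map (λ k → h k ∸ 1) ks) ≡ 0 → Twos ks ≡ 0 × Threes ks ≡ 0
    no-excess []       _ = refl , refl
    no-excess (k ∷ ks) e with h k
    ... | 0                 = no-excess ks e
    ... | 1                 = no-excess ks e
    ... | 2                 = contradiction e λ ()
    ... | suc (suc (suc _)) = contradiction e λ ()

    excess-free : ∀ ks → Twos ks ≡ 0 → Threes ks ≡ 0 → sumℕ (map (λ k → h k ∸ 1) ks) ≡ 0
    excess-free []       _  _  = refl
    excess-free (k ∷ ks) t₀ h₀ with h k
    ... | 0                 = excess-free ks t₀ h₀
    ... | 1                 = excess-free ks t₀ h₀
    ... | 2                 = contradiction t₀ λ ()
    ... | suc (suc (suc _)) = contradiction h₀ λ ()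

    one-excess : ∀ ks → sumℕ (map (λ k → h k ∸ 1) ks) ≡ 1 → Twos ks ≡ 1 × Threes ks ≡ 0
    one-excess []       ()
    one-excess (k ∷ ks) e with h k
    ... | 0                 = one-excess ks e
    ... | 1                 = one-excess ks e
    ... | 2                 = map₁ (cong suc) (no-excess ks (ℕ.suc-injective e))
    ... | suc (suc (suc _)) = contradiction (ℕ.suc-injective e) λ ()

    excess-one : ∀ ks → Twos ks ≡ 1 → Threes ks ≡ 0 → sumℕ (map (λ k → h k ∸ 1) ks) ≡ 1
    excess-one []       ()
    excess-one (k ∷ ks) t₁ h₀ with h k
    ... | 0                 = excess-one ks t₁ h₀
    ... | 1                 = excess-one ks t₁ h₀
    ... | 2                 = cong suc (excess-free ks (ℕ.suc-injective t₁) h₀)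
    ... | suc (suc (suc _)) = contradiction h₀ λ ()

  parts≤size : ∀ l → PartsAtMost (size l) l
  parts≤size []            = []
  parts≤size ((a , x) ∷ t) = ℕ.m≤m+n a (size t) ∷ All.map (λ b≤ → ℕ.≤-trans b≤ (ℕ.m≤n+m (size t) a)) (parts≤size t)

  parts<1+largest : ∀ {l} → Linked Step l → All (λ p → proj₁ p < suc (largest l)) l
  parts<1+largest []              = []
  parts<1+largest {(a , x) ∷ t} s = ℕ.n<1+n a ∷ All.map s≤s (sorted-bound s)

  OneDoubleCondition : List Part → Set
  OneDoubleCondition l = Twos (λ k → mult k l) (upTo (suc (largest l))) ≡ 1
                       × Threes (λ k → mult k l) (upTo (suc (largest l))) ≡ 0

  oneDouble↔WithRepeats : ∀ n → OneDouble n ↔ WithRepeats 1 n n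
  oneDouble↔WithRepeats n = Σ-prop-↔ {P = OneDoubleCondition ∘ ps} {Q = Repeated 1 n ∘ ps}
                                     (λ _ → ×-irrelevant ℕ.≡-irrelevant ℕ.≡-irrelevant) (Repeated-irrelevant ∘ ps) to from
    where
    repeats≡excess : (π : Overpartition n) → repeats (ps π) ≡ excess (ps π) (suc (largest (ps π)))
    repeats≡excess π = repeats-excess (sorted π) (parts<1+largest (sorted π))
    to : ∀ π → OneDoubleCondition (ps π) → Repeated 1 n (ps π)
    to π (t₁ , h₀) = subst (λ k → PartsAtMost k (ps π)) (total π) (parts≤size (ps π)) ,
                     trans (repeats≡excess π) (excess-one (λ k → mult k (ps π)) (upTo (suc (largest (ps π)))) t₁ h₀)
    from : ∀ π → Repeated 1 n (ps π) → OneDoubleCondition (ps π)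
    from π (_ , r) = one-excess (λ k → mult k (ps π)) (upTo (suc (largest (ps π)))) (trans (sym (repeats≡excess π)) r)

module MissingParts where

  open Counting using (Shifted; Shifted-cong; Shifted-cast; Shifted-Shifted; ⊎-emptyʳ; Recurrence)
  open Overpartitions
  open import Data.Nat using (_+_; _*_; _∸_; _≤_; _<_; z≤n; s≤s; _≟_)
  import Data.Nat.Properties as ℕ
  open import Data.Bool using (Bool; true; false)
  open import Data.List using (List; []; _∷_; _++_; length; replicate; map; filter; upTo; applyUpTo)
  import Data.List.Properties as List
  open import Data.Nat.ListAction.Properties using (sum-++)
  open import Data.List.Relation.Unary.All as All using (All; []; _∷_)
  import Data.List.Relation.Unary.All.Properties as All
  open import Data.List.Relation.Unary.Linked as Linked using (Linked; []; [-]; _∷_)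
  import Data.List.Relation.Unary.Linked.Properties as Linked
  open import Data.Product using (Σ; _×_; _,_; proj₁; proj₂; map₁; map₂)
  open import Data.Sum using (_⊎_; inj₁; inj₂)
  open import Data.Sum.Function.Propositional using (_⊎-↔_)
  open import Function.Bundles using (_↔_; mk↔ₛ′)
  open import Function.Properties.Inverse using (↔-refl; ↔-trans)
  open import Relation.Binary.PropositionalEquality
  open import Relation.Nullary using (¬_; yes; no; does; contradiction)
  open import Relation.Nullary.Irrelevant using (Irrelevant)
  open ≡-Reasoning

  raise lower : List Part → List Part
  raise = map (map₁ suc)
  lower = map (map₁ (_∸ 1))

  ones : Bool → ℕ → List Part
  ones f e = (1 , f) ∷ replicate e (1 , false)

  addColumn : Bool → ℕ → List Part → List Part
  addColumn f e μ = raise μ ++ ones f e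

  removeColumn : List Part → List Part
  removeColumn ((suc (suc a) , x) ∷ l) = (suc a , x) ∷ removeColumn l
  removeColumn _                       = []

  firstOneFlag : List Part → Bool
  firstOneFlag ((suc (suc _) , _) ∷ l) = firstOneFlag l
  firstOneFlag ((_ , x) ∷ _)           = x
  firstOneFlag []                      = false

  Step-raise : ∀ {a x b y} → Step (a , x) (b , y) → Step (suc a , x) (suc b , y)
  Step-raise (lt b<a) = lt (s≤s b<a)
  Step-raise eq       = eq

  Step-lower : ∀ {a x b y} → Step (suc a , x) (suc b , y) → Step (a , x) (b , y)
  Step-lower (lt (s≤s b<a)) = lt b<a
  Step-lower eq             = eq

  raise-sorted : ∀ {μ} → Linked Step μ → Linked Step (raise μ)
  raise-sorted = Linked.map⁺ ∘ Linked.map Step-raise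

  raise-sorted⁻ : ∀ {μ} → Linked Step (raise μ) → Linked Step μ
  raise-sorted⁻ = Linked.map Step-lower ∘ Linked.map⁻

  raise-positive : ∀ μ → Positive (raise μ)
  raise-positive []      = []
  raise-positive (_ ∷ μ) = s≤s z≤n ∷ raise-positive μ

  ones-sorted : ∀ f e → Linked Step (ones f e)
  ones-sorted f zero    = [-]
  ones-sorted f (suc e) = eq ∷ ones-sorted false e

  ones-positive : ∀ f e → Positive (ones f e)
  ones-positive f e = All.++⁺ (s≤s z≤n ∷ []) (All.replicate⁺ e (s≤s z≤n))

  addColumn-sorted : ∀ {f e μ} → Positive μ → Linked Step μ → Linked Step (addColumn f e μ)
  addColumn-sorted {f} {e} []          []       = ones-sorted f e
  addColumn-sorted         (1≤a ∷ [])  [-]      = lt (s≤s 1≤a) ∷ ones-sorted _ _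
  addColumn-sorted         (_ ∷ pos)   (st ∷ s) = Step-raise st ∷ addColumn-sorted pos s

  addColumn-positive : ∀ f e μ → Positive (addColumn f e μ)
  addColumn-positive f e μ = All.++⁺ (raise-positive μ) (ones-positive f e)

  removeColumn-positive : ∀ l → Positive (removeColumn l)
  removeColumn-positive ((suc (suc a) , x) ∷ l) = s≤s z≤n ∷ removeColumn-positive l
  removeColumn-positive ((suc zero , x) ∷ l)    = []
  removeColumn-positive ((zero , x) ∷ l)        = []
  removeColumn-positive []                      = []

  removeColumn-sorted : ∀ {l} → Linked Step l → Linked Step (removeColumn l)
  removeColumn-sorted {(suc (suc a) , x) ∷ (suc (suc b) , y) ∷ l} (st ∷ s) = Step-lower st ∷ removeColumn-sorted s
  removeColumn-sorted {(suc (suc a) , x) ∷ (suc zero , y) ∷ l}    _        = [-]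
  removeColumn-sorted {(suc (suc a) , x) ∷ (zero , y) ∷ l}        _        = [-]
  removeColumn-sorted {(suc (suc a) , x) ∷ []}                    _        = [-]
  removeColumn-sorted {(suc zero , x) ∷ l}                        _        = []
  removeColumn-sorted {(zero , x) ∷ l}                            _        = []
  removeColumn-sorted {[]}                                        _        = []

  removeColumn-addColumn : ∀ f e {μ} → Positive μ → removeColumn (addColumn f e μ) ≡ μ
  removeColumn-addColumn f e []                             = refl
  removeColumn-addColumn f e {(suc a , x) ∷ μ} (_ ∷ pos) = cong ((suc a , x) ∷_) (removeColumn-addColumn f e pos)

  firstOneFlag-addColumn : ∀ f e {μ} → Positive μ → firstOneFlag (addColumn f e μ) ≡ f
  firstOneFlag-addColumn f e []                             = refl
  firstOneFlag-addColumn f e {(suc a , x) ∷ μ} (_ ∷ pos) = firstOneFlag-addColumn f e pos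

  ones-tail : ∀ {x t} → Linked Step ((1 , x) ∷ t) → Positive t → t ≡ replicate (length t) (1 , false)
  ones-tail [-]                  []      = refl
  ones-tail (lt (s≤s z≤n) ∷ _)   (() ∷ _)
  ones-tail (eq ∷ s)             (_ ∷ pos) = cong ((1 , false) ∷_) (ones-tail s pos)

  column-decomposition : ∀ {l} → Linked Step l → Positive l → 1 ≤ mult 1 l →
                         Σ ℕ λ e → l ≡ addColumn (firstOneFlag l) e (removeColumn l)
  column-decomposition {(suc zero , x) ∷ t}      s (_ ∷ pos) _   = length t , cong ((1 , x) ∷_) (ones-tail s pos)
  column-decomposition {(suc (suc a) , x) ∷ t}   s (_ ∷ pos) has =
    map₂ (cong ((suc (suc a) , x) ∷_)) (column-decomposition (Linked.tail s) pos has)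
  column-decomposition {(zero , x) ∷ t}          s (() ∷ _)  _
  column-decomposition {[]}                      s []        ()

  no-ones-parts : ∀ {l} → Positive l → mult 1 l ≡ 0 → All (λ p → 2 ≤ proj₁ p) l
  no-ones-parts {[]}                    []        _      = []
  no-ones-parts {(suc (suc a) , x) ∷ t} (_ ∷ pos) no-one = s≤s (s≤s z≤n) ∷ no-ones-parts pos no-one
  no-ones-parts {(suc zero , x) ∷ t}    (_ ∷ pos) ()
  no-ones-parts {(zero , x) ∷ t}        (() ∷ _)  _

  raise-lower : ∀ {l} → All (λ p → 2 ≤ proj₁ p) l → raise (lower l) ≡ l
  raise-lower []                    = refl
  raise-lower (s≤s (s≤s z≤n) ∷ big) = cong (_ ∷_) (raise-lower big)

  lower-raise : ∀ μ → lower (raise μ) ≡ μ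
  lower-raise []      = refl
  lower-raise (_ ∷ μ) = cong (_ ∷_) (lower-raise μ)

  lower-positive : ∀ {l} → All (λ p → 2 ≤ proj₁ p) l → Positive (lower l)
  lower-positive []                    = []
  lower-positive (s≤s (s≤s z≤n) ∷ big) = s≤s z≤n ∷ lower-positive big

  size-++ : ∀ xs ys → size (xs ++ ys) ≡ size xs + size ys
  size-++ xs ys = trans (cong sumℕ (List.map-++ proj₁ xs ys)) (sum-++ (parts xs) (parts ys))

  size-raise : ∀ μ → size (raise μ) ≡ size μ + length μ
  size-raise []            = refl
  size-raise ((a , _) ∷ μ) = begin
    suc (a + size (raise μ))       ≡⟨ cong (λ s → suc (a + s)) (size-raise μ) ⟩
    suc (a + (size μ + length μ))  ≡⟨ cong suc (ℕ.+-assoc a (size μ) (length μ)) ⟨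
    suc (a + size μ + length μ)    ≡⟨ ℕ.+-suc (a + size μ) (length μ) ⟨
    a + size μ + suc (length μ)    ∎

  size-ones : ∀ f e → size (ones f e) ≡ suc e
  size-ones f zero    = refl
  size-ones f (suc e) = cong suc (size-ones false e)

  length-ones : ∀ f e → length (ones f e) ≡ suc e
  length-ones f e = cong suc (List.length-replicate e)

  length-addColumn : ∀ f e μ → length (addColumn f e μ) ≡ length μ + suc e
  length-addColumn f e μ = trans (List.length-++ (raise μ)) (cong₂ _+_ (List.length-map _ μ) (length-ones f e))

  size-addColumn : ∀ f e μ → size (addColumn f e μ) ≡ size μ + (length μ + suc e)
  size-addColumn f e μ = begin
    size (raise μ ++ ones f e)          ≡⟨ size-++ (raise μ) (ones f e) ⟩
    size (raise μ) + size (ones f e)    ≡⟨ cong₂ _+_ (size-raise μ) (size-ones f e) ⟩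
    size μ + length μ + suc e           ≡⟨ ℕ.+-assoc (size μ) _ _ ⟩
    size μ + (length μ + suc e)         ∎

  mult-raise : ∀ k μ → mult (suc k) (raise μ) ≡ mult k μ
  mult-raise k []            = refl
  mult-raise k ((a , x) ∷ μ) with k ≟ a
  ... | yes refl = trans (mult-∷-≡ (suc k) x (raise μ)) (trans (cong suc (mult-raise k μ)) (sym (mult-∷-≡ k x μ)))
  ... | no k≢a   =
    trans (mult-∷-≢ x (raise μ) (k≢a ∘ ℕ.suc-injective)) (trans (mult-raise k μ) (sym (mult-∷-≢ x μ k≢a)))

  mult-1-raise : ∀ {μ} → Positive μ → mult 1 (raise μ) ≡ 0
  mult-1-raise []             = refl
  mult-1-raise (s≤s z≤n ∷ pos) = mult-1-raise pos

  mult-ones : ∀ k f e → mult (suc (suc k)) (ones f e) ≡ 0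
  mult-ones k f zero    = refl
  mult-ones k f (suc e) = mult-ones k false e

  mult-1-addColumn : ∀ f e μ → 1 ≤ mult 1 (addColumn f e μ)
  mult-1-addColumn f e μ = subst (1 ≤_) (sym (mult-++ 1 (raise μ) (ones f e)))
                                 (subst (1 ≤_) (sym (ℕ.+-suc (mult 1 (raise μ)) _)) (s≤s z≤n))

  zeros : (ℕ → ℕ) → List ℕ → ℕ
  zeros f ks = length (filter (λ k → f k ≟ 0) ks)

  zeros-++ : ∀ f ks ks′ → zeros f (ks ++ ks′) ≡ zeros f ks + zeros f ks′
  zeros-++ f ks ks′ =
    trans (cong length (List.filter-++ (λ k → f k ≟ 0) ks ks′)) (List.length-++ (filter (λ k → f k ≟ 0) ks))

  zeros-map : ∀ f g ks → zeros f (map g ks) ≡ zeros (f ∘ g) ks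
  zeros-map f g []       = refl
  zeros-map f g (k ∷ ks) with does (f (g k) ≟ 0)
  ... | true  = cong suc (zeros-map f g ks)
  ... | false = zeros-map f g ks

  zeros-cong : ∀ {f g} → (∀ k → f k ≡ g k) → ∀ ks → zeros f ks ≡ zeros g ks
  zeros-cong f≗g ks = cong length (List.filter-≐ _ _ ((λ {k} → trans (sym (f≗g k))) , (λ {k} → trans (f≗g k))) ks)

  zeros-zero : ∀ {f k} → f k ≡ 0 → zeros f (k ∷ []) ≡ 1
  zeros-zero {f} fk≡0 = cong length (List.filter-accept (λ k → f k ≟ 0) fk≡0)

  zeros-nonzero : ∀ {f k} → f k ≢ 0 → zeros f (k ∷ []) ≡ 0
  zeros-nonzero {f} fk≢0 = cong length (List.filter-reject (λ k → f k ≟ 0) fk≢0)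

  missing-shift : ∀ L M {a} → largest L ≡ suc (suc a) → largest M ≡ suc a →
                  (∀ k → mult (suc (suc k)) L ≡ mult (suc k) M) →
                  missingCount L ≡ zeros (λ k → mult k L) (1 ∷ []) + missingCount M
  missing-shift L M {a} L-largest M-largest mult≡ = begin
    missingCount L
      ≡⟨ cong (λ r → zeros (λ k → mult k L) (map suc (upTo (r ∸ 1)))) L-largest ⟩
    zeros (λ k → mult k L) (1 ∷ map suc (applyUpTo suc a))
      ≡⟨ zeros-++ (λ k → mult k L) (1 ∷ []) (map suc (applyUpTo suc a)) ⟩
    zeros (λ k → mult k L) (1 ∷ []) + zeros (λ k → mult k L) (map suc (applyUpTo suc a))
      ≡⟨ cong (zeros (λ k → mult k L) (1 ∷ []) +_) above-one ⟩
    zeros (λ k → mult k L) (1 ∷ []) + missingCount M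
      ∎
    where
    above-one : zeros (λ k → mult k L) (map suc (applyUpTo suc a)) ≡ missingCount M
    above-one = begin
      zeros (λ k → mult k L) (map suc (applyUpTo suc a))
        ≡⟨ cong (zeros (λ k → mult k L) ∘ map suc) (List.map-upTo suc a) ⟨
      zeros (λ k → mult k L) (map suc (map suc (upTo a)))
        ≡⟨ zeros-map (λ k → mult k L) suc (map suc (upTo a)) ⟩
      zeros (λ k → mult (suc k) L) (map suc (upTo a))
        ≡⟨ zeros-map (λ k → mult (suc k) L) suc (upTo a) ⟩
      zeros (λ k → mult (suc (suc k)) L) (upTo a)
        ≡⟨ zeros-cong mult≡ (upTo a) ⟩
      zeros (λ k → mult (suc k) M) (upTo a)
        ≡⟨ zeros-map (λ k → mult k M) suc (upTo a) ⟨
      zeros (λ k → mult k M) (map suc (upTo a))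
        ≡⟨ cong (λ r → zeros (λ k → mult k M) (map suc (upTo (r ∸ 1)))) M-largest ⟨
      missingCount M
        ∎

  missing-addColumn : ∀ f e {μ} → Positive μ → missingCount (addColumn f e μ) ≡ missingCount μ
  missing-addColumn f e []                          = refl
  missing-addColumn f e {(suc a , x) ∷ μ} (_ ∷ pos) = begin
    missingCount L                                   ≡⟨ missing-shift L μ′ refl refl mult≡ ⟩
    zeros (λ k → mult k L) (1 ∷ []) + missingCount μ′  ≡⟨ cong (_+ missingCount μ′) (zeros-nonzero {λ k → mult k L} {1} one≢0) ⟩
    missingCount μ′                                  ∎
    where
    μ′ = (suc a , x) ∷ μ
    L = addColumn f e μ′
    one≢0 : mult 1 L ≢ 0
    one≢0 = ℕ.>⇒≢ (mult-1-addColumn f e μ′)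
    mult≡ : ∀ k → mult (suc (suc k)) L ≡ mult (suc k) μ′
    mult≡ k = begin
      mult (suc (suc k)) (raise μ′ ++ ones f e)                      ≡⟨ mult-++ (suc (suc k)) (raise μ′) (ones f e) ⟩
      mult (suc (suc k)) (raise μ′) + mult (suc (suc k)) (ones f e)  ≡⟨ cong₂ _+_ (mult-raise (suc k) μ′) (mult-ones k f e) ⟩
      mult (suc k) μ′ + 0                                            ≡⟨ ℕ.+-identityʳ _ ⟩
      mult (suc k) μ′                                                ∎

  missing-raise : ∀ {ν} → Positive ν → ν ≢ [] → missingCount (raise ν) ≡ suc (missingCount ν)
  missing-raise []                      ν≢[] = contradiction refl ν≢[]
  missing-raise {(suc a , x) ∷ ν} pos _ = begin
    missingCount L                                   ≡⟨ missing-shift L ν′ refl refl (λ k → mult-raise (suc k) ν′) ⟩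
    zeros (λ k → mult k L) (1 ∷ []) + missingCount ν′  ≡⟨ cong (_+ missingCount ν′) (zeros-zero {λ k → mult k L} {1} (mult-1-raise pos)) ⟩
    suc (missingCount ν′)                            ∎
    where
    ν′ = (suc a , x) ∷ ν
    L = raise ν′

  column-view : ∀ {m l} → Linked Step l → Positive l → 1 ≤ mult 1 l → length l ≡ suc m →
                length (removeColumn l) ≤ m × l ≡ addColumn (firstOneFlag l) (m ∸ length (removeColumn l)) (removeColumn l)
  column-view {m} {l} s pos has-one len with column-decomposition s pos has-one
  ... | e , l≡ = ℕ.≤-pred (subst (length μ <_) len′ (ℕ.m<m+n (length μ) (s≤s z≤n))) ,
                 trans l≡ (cong (λ e → addColumn f e μ) e≡)
    where
    μ = removeColumn l
    f = firstOneFlag l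
    len′ : length μ + suc e ≡ suc m
    len′ = trans (sym (length-addColumn f e μ)) (trans (cong length (sym l≡)) len)
    e≡ : e ≡ m ∸ length μ
    e≡ = trans (sym (ℕ.m+n∸m≡n (length μ) e))
               (cong (_∸ length μ) (ℕ.suc-injective (trans (sym (ℕ.+-suc (length μ) e)) len′)))

  fill : ∀ {m} (μ : List Part) → length μ ≤ m → length μ + suc (m ∸ length μ) ≡ suc m
  fill μ len = trans (ℕ.+-suc (length μ) _) (cong suc (ℕ.m+[n∸m]≡n len))

  missing-lower : ∀ {l} → Positive l → mult 1 l ≡ 0 → l ≢ [] → missingCount l ≡ suc (missingCount (lower l))
  missing-lower {l} pos no-one l≢[] =
    trans (cong missingCount (sym l≡)) (missing-raise (lower-positive big) (λ ν≡[] → l≢[] (trans (sym l≡) (cong raise ν≡[]))))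
    where
    big = no-ones-parts pos no-one
    l≡ = raise-lower big

  nonempty : ∀ {l : List Part} {m} → length l ≡ suc m → l ≢ []
  nonempty len refl = ℕ.0≢1+n len

  Missing MissingExact : ℕ → ℕ → List Part → Set
  Missing      d m l = length l ≤ m × missingCount l ≡ d
  MissingExact d m l = length l ≡ m × missingCount l ≡ d

  WithMissing : ℕ → ℕ → ℕ → Set
  WithMissing d m = OverpartitionsWith (Missing d m)

  MissingWithOnes MissingNoOnes : ℕ → ℕ → List Part → Set
  MissingWithOnes d m l = MissingExact d (suc m) l × 1 ≤ mult 1 l
  MissingNoOnes   d m l = MissingExact d (suc m) l × mult 1 l ≡ 0

  Missing-irrelevant : ∀ {d m} l → Irrelevant (Missing d m l)
  Missing-irrelevant _ = ×-irrelevant ℕ.≤-irrelevant ℕ.≡-irrelevant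

  MissingExact-irrelevant : ∀ {d m} l → Irrelevant (MissingExact d m l)
  MissingExact-irrelevant _ = ×-irrelevant ℕ.≡-irrelevant ℕ.≡-irrelevant

  MissingWithOnes-irrelevant : ∀ {d m} l → Irrelevant (MissingWithOnes d m l)
  MissingWithOnes-irrelevant l = ×-irrelevant (MissingExact-irrelevant l) ℕ.≤-irrelevant

  MissingNoOnes-irrelevant : ∀ {d m} l → Irrelevant (MissingNoOnes d m l)
  MissingNoOnes-irrelevant l = ×-irrelevant (MissingExact-irrelevant l) ℕ.≡-irrelevant

  split-length : ∀ d m n → WithMissing d (suc m) n ↔ (WithMissing d m n ⊎ OverpartitionsWith (MissingExact d (suc m)) n)
  split-length d m n =
    split-with (Missing d (suc m)) (Missing d m) (MissingExact d (suc m))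
               Missing-irrelevant Missing-irrelevant MissingExact-irrelevant disjoint split join
    where
    split : ∀ π → Missing d (suc m) (ps π) → Missing d m (ps π) ⊎ MissingExact d (suc m) (ps π)
    split π (len , miss) with ℕ.m≤n⇒m<n∨m≡n len
    ... | inj₁ len<1+m = inj₁ (ℕ.≤-pred len<1+m , miss)
    ... | inj₂ len≡1+m = inj₂ (len≡1+m , miss)
    join : ∀ l → Missing d m l ⊎ MissingExact d (suc m) l → Missing d (suc m) l
    join _ (inj₁ (len , miss)) = ℕ.m≤n⇒m≤1+n len , miss
    join _ (inj₂ (len , miss)) = ℕ.≤-reflexive len , miss
    disjoint : ∀ l → Missing d m l → ¬ MissingExact d (suc m) l
    disjoint _ (len≤m , _) (len≡1+m , _) = ℕ.<-irrefl refl (subst (_≤ m) len≡1+m len≤m)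

  split-ones : ∀ d m n → OverpartitionsWith (MissingExact d (suc m)) n ↔
                         (OverpartitionsWith (MissingWithOnes d m) n ⊎ OverpartitionsWith (MissingNoOnes d m) n)
  split-ones d m n =
    split-with (MissingExact d (suc m)) (MissingWithOnes d m) (MissingNoOnes d m)
               MissingExact-irrelevant MissingWithOnes-irrelevant MissingNoOnes-irrelevant disjoint split join
    where
    split : ∀ π → MissingExact d (suc m) (ps π) → MissingWithOnes d m (ps π) ⊎ MissingNoOnes d m (ps π)
    split π p with mult 1 (ps π)
    ... | zero  = inj₂ (p , refl)
    ... | suc _ = inj₁ (p , s≤s z≤n)
    join : ∀ l → MissingWithOnes d m l ⊎ MissingNoOnes d m l → MissingExact d (suc m) l
    join _ (inj₁ (p , _)) = p
    join _ (inj₂ (p , _)) = p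
    disjoint : ∀ l → MissingWithOnes d m l → ¬ MissingNoOnes d m l
    disjoint _ (_ , has-one) (_ , no-one) = ℕ.<-irrefl refl (subst (1 ≤_) no-one has-one)

  no-ones-missing : ∀ m n → ¬ OverpartitionsWith (MissingNoOnes 0 m) n
  no-ones-missing m n (π , (len , miss) , no-one) = ℕ.1+n≢0 (trans (sym (missing-lower (positive π) no-one (nonempty len))) miss)

  remove-column : ∀ d m n → OverpartitionsWith (MissingWithOnes d m) n ↔ Shifted (suc m) (λ k → Bool × WithMissing d m k) n
  remove-column d m n = mk↔ₛ′ to from to∘from from∘to
    where
    to : OverpartitionsWith (MissingWithOnes d m) n → Shifted (suc m) (λ k → Bool × WithMissing d m k) n
    to (mkOP l pos s total , (len , miss) , has-one) =
      size μ , n≡ , firstOneFlag l , mkOP μ (removeColumn-positive l) (removeColumn-sorted s) refl , μ-len , μ-miss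
      where
      μ = removeColumn l
      view = column-view s pos has-one len
      μ-len = proj₁ view
      n≡ : n ≡ suc m + size μ
      n≡ = trans (sym total) (trans (cong size (proj₂ view))
                 (trans (size-addColumn _ _ μ) (trans (cong (size μ +_) (fill μ μ-len)) (ℕ.+-comm (size μ) (suc m)))))
      μ-miss = trans (sym (missing-addColumn _ _ (removeColumn-positive l))) (trans (cong missingCount (sym (proj₂ view))) miss)
    from : Shifted (suc m) (λ k → Bool × WithMissing d m k) n → OverpartitionsWith (MissingWithOnes d m) n
    from (k , n≡ , f , mkOP μ pos s total , len , miss) =
      mkOP (addColumn f e μ) (addColumn-positive f e μ) (addColumn-sorted pos s) size≡ ,
      (trans (length-addColumn f e μ) (fill μ len) , trans (missing-addColumn f e pos) miss) , mult-1-addColumn f e μ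
      where
      e = m ∸ length μ
      size≡ = trans (size-addColumn f e μ) (trans (cong₂ _+_ total (fill μ len)) (trans (ℕ.+-comm k (suc m)) (sym n≡)))
    to∘from : ∀ w → to (from w) ≡ w
    to∘from (_ , _ , f , mkOP μ pos _ _ , _) =
      Flagged-≡ Missing-irrelevant (firstOneFlag-addColumn f _ pos) (removeColumn-addColumn f _ pos)
    from∘to : ∀ u → from (to u) ≡ u
    from∘to (mkOP l pos s _ , (len , _) , has-one) = With-≡ MissingWithOnes-irrelevant (sym (proj₂ (column-view s pos has-one len)))

  lower-parts : ∀ d m n → OverpartitionsWith (MissingNoOnes (suc d) m) n ↔
                          Shifted (suc m) (OverpartitionsWith (MissingExact d (suc m))) n
  lower-parts d m n = mk↔ₛ′ to from to∘from from∘to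
    where
    to : OverpartitionsWith (MissingNoOnes (suc d) m) n → Shifted (suc m) (OverpartitionsWith (MissingExact d (suc m))) n
    to (mkOP l pos s total , (len , miss) , no-one) =
      size ν , n≡ , mkOP ν (lower-positive big) (raise-sorted⁻ (subst (Linked Step) (sym l≡) s)) refl , ν-len , ν-miss
      where
      big = no-ones-parts pos no-one
      ν = lower l
      l≡ = raise-lower big
      ν-len = trans (List.length-map _ l) len
      n≡ : n ≡ suc m + size ν
      n≡ = trans (sym total) (trans (cong size (sym l≡))
                 (trans (size-raise ν) (trans (cong (size ν +_) ν-len) (ℕ.+-comm (size ν) (suc m)))))
      ν-miss = ℕ.suc-injective (trans (sym (missing-lower pos no-one (nonempty len))) miss)
    from : Shifted (suc m) (OverpartitionsWith (MissingExact d (suc m))) n → OverpartitionsWith (MissingNoOnes (suc d) m) n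
    from (k , n≡ , mkOP ν pos s total , len , miss) =
      mkOP (raise ν) (raise-positive ν) (raise-sorted s) size≡ ,
      (trans (List.length-map _ ν) len , trans (missing-raise pos (nonempty len)) (cong suc miss)) , mult-1-raise pos
      where
      size≡ = trans (size-raise ν) (trans (cong₂ _+_ total len) (trans (ℕ.+-comm k (suc m)) (sym n≡)))
    to∘from : ∀ w → to (from w) ≡ w
    to∘from (_ , _ , mkOP ν _ _ _ , _) = Shifted-≡ MissingExact-irrelevant (lower-raise ν)
    from∘to : ∀ u → from (to u) ≡ u
    from∘to (mkOP _ pos _ _ , _ , no-one) = With-≡ MissingNoOnes-irrelevant (raise-lower (no-ones-parts pos no-one))

  length≤0-empty : ∀ {l : List Part} → length l ≤ 0 → l ≡ []
  length≤0-empty {[]} _ = refl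

  missing-recurrence : Recurrence WithMissing
  missing-recurrence = record
    { Rest  = λ d m → OverpartitionsWith (MissingNoOnes d m)
    ; base₀ = only-empty Missing-irrelevant (λ _ → length≤0-empty ∘ proj₁) (z≤n , refl)
    ; base₁ = λ n → only-empty-¬ (λ _ → length≤0-empty ∘ proj₁) (λ ())
    ; step  = λ d m n → ↔-trans (split-length d m n) (↔-refl ⊎-↔ ↔-trans (split-ones d m n) (remove-column d m n ⊎-↔ ↔-refl))
    ; rest₀ = no-ones-missing
    ; rest₁ = rest₁
    }
    where
    rest₁ : ∀ m n → OverpartitionsWith (MissingNoOnes 1 m) n ↔ Shifted (2 * suc m) (λ k → Bool × WithMissing 0 m k) n
    rest₁ m n = ↔-trans (lower-parts 0 m n)
               (↔-trans (Shifted-cong (suc m) with-ones n)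
               (↔-trans (Shifted-Shifted (suc m) (suc m))
                        (Shifted-cast (cong (suc m +_) (sym (ℕ.+-identityʳ (suc m)))))))
      where
      with-ones : ∀ k → OverpartitionsWith (MissingExact 0 (suc m)) k ↔ Shifted (suc m) (λ k → Bool × WithMissing 0 m k) k
      with-ones k = ↔-trans (split-ones 0 m k) (↔-trans (⊎-emptyʳ (no-ones-missing m k)) (remove-column 0 m k))

  oneMissing↔WithMissing : ∀ n → OneMissing n ↔ WithMissing 1 n n
  oneMissing↔WithMissing n =
    Σ-prop-↔ (λ _ → ℕ.≡-irrelevant) (Missing-irrelevant ∘ ps) (λ π miss → length≤size π , miss) (λ _ → proj₂)
    where
    length≤size : (π : Overpartition n) → length (ps π) ≤ n
    length≤size (mkOP l pos _ total) = subst (length l ≤_) total (go pos)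
      where
      go : ∀ {l} → Positive l → length l ≤ size l
      go []          = z≤n
      go (1≤a ∷ pos) = ℕ.+-mono-≤ 1≤a (go pos)

open import Data.Fin using (Fin)
open import Data.Integer using (+_)
open import Data.Product using (Σ; _×_; _,_)
open import Function.Bundles using (_↔_)
open import Function.Properties.Inverse using (↔-sym; ↔-trans)
open Coefficients using (rhsToℕ; rhsToℕ-rhs)
open Counting using (count₁)
open RepeatedParts using (repeats-recurrence)
open Multiplicities using (oneDouble↔WithRepeats)
open MissingParts using (missing-recurrence; oneMissing↔WithMissing)

corollary3p4 : (n : ℕ) → Σ ℕ (λ c → (Fin c ↔ OneMissing n) × ((+ c) ≡ rhs n) × (Fin c ↔ OneDouble n))
corollary3p4 n = rhsToℕ n n , ↔-sym oneMissing-count , rhsToℕ-rhs n , ↔-sym oneDouble-count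
  where
  oneMissing-count : OneMissing n ↔ Fin (rhsToℕ n n)
  oneMissing-count = ↔-trans (oneMissing↔WithMissing n) (count₁ missing-recurrence n n)
  oneDouble-count : OneDouble n ↔ Fin (rhsToℕ n n)
  oneDouble-count = ↔-trans (oneDouble↔WithRepeats n) (count₁ repeats-recurrence n n)
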